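{- State reachability is undecidable for instantaneous $\mu$Stipula (the fragment $\mu$Stipula$^{\tt I}$): there is no algorithm that, given a $\mu$Stipula$^{\tt I}$ contract ${\tt C}$ and a state ${\tt Q}$, decides whether ${\tt Q}$ is reachable in ${\tt C}$.
   Context: A $\mu$Stipula contract ${\tt C}$ consists of a finite set of states, an initial state ${\tt Q}_{\rm init}$, and a finite set of functions. A function has the form $@{\tt Q}\; {\tt f}\,\{W\} \Rightarrow @{\tt Q}'$ (invocable in state ${\tt Q}$, leading to state ${\tt Q}'$), where $W$ is a finite sequence of events; an event has the form ${\tt now}+k \gg @{\tt Q}_1 \Rightarrow @{\tt Q}_2$ with $k\in\mathbb{N}$, and each event occurrence in the contract carries a unique line index $n$. A pending event is a term $k \gg_n {\tt Q}_1 \Rightarrow {\tt Q}_2$ ($k\in\mathbb N$). A configuration is ${\tt C}({\tt Q},\Sigma,\Psi)$ where ${\tt Q}$ is a state, $\Psi$ is a finite multiset of pending events (written with $|$, empty multiset $\_$), and $\Sigma$ is either empty ($\_$) or of the form $\Psi'\Rightarrow{\tt Q}'$ with $\Psi'$ a multiset of pending events. (Configurations also carry a natural-number clock incremented by Tick; it plays no role in reachability.) Let $\mathit{nored}(\Psi,{\tt Q})$ hold iff $\Psi$ contains no pending event of the form $0\gg_n {\tt Q}\Rightarrow {\tt Q}'$. Let $\Psi\!\downarrow$ be obtained from $\Psi$ by deleting all pending events with time $0$ and replacing each $k+1\gg_n{\tt Q}_1\Rightarrow{\tt Q}_2$ by $k\gg_n{\tt Q}_1\Rightarrow{\tt Q}_2$.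 Transitions: (Function) if $@{\tt Q}\,{\tt f}\{W\}\Rightarrow@{\tt Q}'$ is in ${\tt C}$ and $\mathit{nored}(\Psi,{\tt Q})$, then ${\tt C}({\tt Q},\_,\Psi)\to{\tt C}({\tt Q},\Psi_W\Rightarrow{\tt Q}',\Psi)$, where $\Psi_W$ is the multiset of $k\gg_n{\tt Q}_1\Rightarrow{\tt Q}_2$ for each event ${\tt now}+k\gg@{\tt Q}_1\Rightarrow@{\tt Q}_2$ (line $n$) in $W$; (State-Change) ${\tt C}({\tt Q},\Psi'\Rightarrow{\tt Q}',\Psi)\to{\tt C}({\tt Q}',\_,\Psi'|\Psi)$; (Event-Match) ${\tt C}({\tt Q},\_,0\gg_n{\tt Q}\Rightarrow{\tt Q}'\,|\,\Psi')\to{\tt C}({\tt Q},\_\Rightarrow{\tt Q}',\Psi')$; (Tick) if $\mathit{nored}(\Psi,{\tt Q})$ then ${\tt C}({\tt Q},\_,\Psi)\to{\tt C}({\tt Q},\_,\Psi\!\downarrow)$. The initial configuration is ${\tt C}({\tt Q}_{\rm init},\_,\_)$. A state ${\tt Q}$ is reachable in ${\tt C}$ iff ${\tt C}({\tt Q}_{\rm init},\_,\_)\to^*{\tt C}({\tt Q},\_,\Psi)$ for some $\Psi$. The fragment $\mu$Stipula$^{\tt I}$ consists of contracts in which every event has time expression ${\tt now}+0$. -}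

module Defs where

open import Data.Nat using (ℕ; zero; suc; _+_; _≡ᵇ_)
open import Data.Bool using (if_then_else_)
open import Data.List using (List; []; _∷_; _++_; map; concatMap)
open import Data.List.Relation.Unary.All using (All)
open import Data.List.Relation.Unary.Unique.Propositional using (Unique)
open import Data.List.Membership.Propositional using (_∈_)
open import Data.Maybe using (Maybe; just; nothing; _>>=_)
open import Data.Product using (_×_; _,_; ∃; ∃-syntax; Σ)
open import Relation.Binary.PropositionalEquality using (_≡_)
open import Relation.Binary.Construct.Closure.ReflexiveTransitive using (Star)
open import Relation.Nullary using (¬_)

-- An event  now + time ≫ @src ⇒ @tgt  occurring at line index `line`.
record Event : Set where
  constructor mkEvent
  field
    time : ℕ
    line : ℕ
    src  : ℕ
    tgt  : ℕ
open Event public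

-- A function  @from f { body } ⇒ @to  (the function name plays no role).
record Fun : Set where
  constructor mkFun
  field
    from : ℕ
    body : List Event
    to   : ℕ
open Fun public

record Contract : Set where
  constructor mkContract
  field
    init  : ℕ
    funs  : List Fun
open Contract public

allEvents : Contract → List Event
allEvents C = concatMap body (funs C)

WellFormed : Contract → Set
WellFormed C = Unique (map line (allEvents C))

Instantaneous : Contract → Set
Instantaneous C = All (λ e → time e ≡ 0) (allEvents C)

-- A pending event  k ≫_n Q1 ⇒ Q2  is represented by an Event record.
-- Multisets of pending events are represented by lists; all rules are
-- insensitive to order (Event-Match may pick an element at any position).

PendingMS : Set
PendingMS = List Event

-- Σ : either empty (nothing) or  Ψ' ⇒ Q'  (just (Ψ' , Q'))
record Config : Set where
  constructor ⟨_,_,_⟩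
  field
    state   : ℕ
    sigma   : Maybe (PendingMS × ℕ)
    pending : PendingMS
open Config public

nored : PendingMS → ℕ → Set
nored Ψ Q = All (λ e → ¬ (time e ≡ 0 × src e ≡ Q)) Ψ

tick : PendingMS → PendingMS
tick [] = []
tick (mkEvent zero n q₁ q₂ ∷ Ψ) = tick Ψ
tick (mkEvent (suc k) n q₁ q₂ ∷ Ψ) = mkEvent k n q₁ q₂ ∷ tick Ψ

data Step (C : Contract) : Config → Config → Set where
  function : ∀ {Q Ψ} (f : Fun) → f ∈ funs C → from f ≡ Q → nored Ψ Q →
    Step C ⟨ Q , nothing , Ψ ⟩ ⟨ Q , just (body f , to f) , Ψ ⟩
  stateChange : ∀ {Q Q' Ψ Ψ'} →
    Step C ⟨ Q , just (Ψ' , Q') , Ψ ⟩ ⟨ Q' , nothing , Ψ' ++ Ψ ⟩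
  eventMatch : ∀ {Q Q' n Ψ₁ Ψ₂} →
    Step C ⟨ Q , nothing , Ψ₁ ++ (mkEvent 0 n Q Q' ∷ Ψ₂) ⟩
           ⟨ Q , just ([] , Q') , Ψ₁ ++ Ψ₂ ⟩
  tickStep : ∀ {Q Ψ} → nored Ψ Q →
    Step C ⟨ Q , nothing , Ψ ⟩ ⟨ Q , nothing , tick Ψ ⟩

Reachable : Contract → ℕ → Set
Reachable C Q = ∃[ Ψ ] Star (Step C) ⟨ init C , nothing , [] ⟩ ⟨ Q , nothing , Ψ ⟩

data Instr : Set where
  inc  : (r l : ℕ) → Instr
  dec  : (r l₁ l₂ : ℕ) → Instr
  halt : Instr

Program : Set
Program = List Instr

record MConf : Set where
  constructor mconf
  field
    pc   : ℕ
    regs : ℕ → ℕ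
open MConf public

nth : {A : Set} → List A → ℕ → Maybe A
nth [] _ = nothing
nth (x ∷ xs) zero = just x
nth (x ∷ xs) (suc i) = nth xs i

update : (ℕ → ℕ) → ℕ → ℕ → (ℕ → ℕ)
update f r v i = if i ≡ᵇ r then v else f i

-- one step; nothing = halted (halt instruction or pc outside program)
mstep : Program → MConf → Maybe MConf
mstep P c with nth P (pc c)
... | nothing = nothing
... | just halt = nothing
... | just (inc r l) = just (mconf l (update (regs c) r (suc (regs c r))))
... | just (dec r l₁ l₂) with regs c r
...   | zero  = just (mconf l₂ (regs c))
...   | suc v = just (mconf l₁ (update (regs c) r v))

exec : Program → ℕ → MConf → Maybe MConf
exec P zero c = just c
exec P (suc n) c = mstep P c >>= exec P n

start : ℕ → MConf
start x = mconf 0 (update (λ _ → 0) 0 x)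

HaltsWith : Program → ℕ → ℕ → Set
HaltsWith P x y = ∃[ n ] ∃[ c ] (exec P n (start x) ≡ just c × mstep P c ≡ nothing × regs c 0 ≡ y)

DecidesOn : Program → ℕ → Set → Set
DecidesOn P x A = (A → HaltsWith P x 1) × (¬ A → HaltsWith P x 0)

tri : ℕ → ℕ
tri zero = 0
tri (suc n) = suc n + tri n

pair : ℕ → ℕ → ℕ
pair a b = tri (a + b) + b

encList : {A : Set} → (A → ℕ) → List A → ℕ
encList e [] = 0
encList e (x ∷ xs) = suc (pair (e x) (encList e xs))

encEvent : Event → ℕ
encEvent (mkEvent k n q₁ q₂) = pair k (pair n (pair q₁ q₂))

encFun : Fun → ℕ
encFun (mkFun q w q') = pair q (pair (encList encEvent w) q')

encContract : Contract → ℕ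
encContract (mkContract q fs) = pair q (encList encFun fs)

encInput : Contract → ℕ → ℕ
encInput C Q = pair (encContract C) Q

-- Reduction from the halting problem for register machines, then diagonalisation.
--
-- A machine P started on E is simulated by an instantaneous contract whose pending events hold
-- the registers: register r has value v when v events probe r ⇒ full r are pending. A decrement
-- of r moves to probe r, where a pending unit must be consumed (it blocks the function leaving
-- probe r) and otherwise that function takes the zero branch; two return events left by the
-- instruction then lead to the right label. The loader emits E units of register 0 and a
-- sentinel halted ⇒ final, which only a halt instruction reaches. Since every event is
-- instantaneous, a Tick erases all pending events, the sentinel included, and final is lost for
-- good. Hence final is reachable iff P halts on E.
--
-- Given a decider M, the program B computes from its input E the code of the question whether
-- final is reachable in machineContract B E, runs M on it, and halts iff M answers no. This is
-- possible since only the loader depends on E. For E the code of the other functions, B halts on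
-- E iff M answers no iff B does not halt on E.

module Submission where

open import Defs
open import Data.Bool using (false; if_then_else_; true)
open import Data.Empty using (⊥; ⊥-elim)
open import Data.Fin using (#_; Fin; toℕ)
open import Data.Fin.Properties using (toℕ<n)
open import Data.List using (List; []; [_]; _++_; _∷_; concatMap; downFrom; length; map; replicate)
open import Data.List.Membership.Propositional using (_∈_)
open import Data.List.Membership.Propositional.Properties using (∈-++⁺ʳ; ∈-++⁺ˡ; ∈-++⁻; ∈-map⁺; ∈-map⁻; ∈-∃++)
open import Data.List.Properties using (++-identityʳ; length-++; length-map; map-++; ∷-injective)
open import Data.List.Relation.Binary.Permutation.Propositional using (_↭_; prep; swap; ↭-refl
  ; ↭-reflexive; ↭-sym; ↭-trans)
open import Data.List.Relation.Binary.Permutation.Propositional.Properties using (++-comm; ++⁺ˡ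
  ; All-resp-↭; drop-∷; shift; ∈-resp-↭)
open import Data.List.Relation.Unary.All as All using (All; []; _∷_)
import Data.List.Relation.Unary.All.Properties as All
open import Data.List.Relation.Unary.AllPairs as AllPairs using ([]; _∷_)
open import Data.List.Relation.Unary.Any using (Any; here; there)
open import Data.List.Relation.Unary.Linked using (Linked; [-]; []; _∷_)
open import Data.List.Relation.Unary.Linked.Properties using (Linked⇒AllPairs)
open import Data.List.Relation.Unary.Unique.Propositional using (Unique)
import Data.List.Relation.Unary.Unique.Propositional.Properties as Unique
open import Data.Maybe using (just; nothing)
open import Data.Nat using (_%_; _*_; _+_; _<_; _<ᵇ_; _≟_; _≡ᵇ_; _≤_; _⊔_; suc; s≤s; zero; z≤n; ℕ)
open import Data.Nat.DivMod using ([m+kn]%n≡m%n; m<n⇒m%n≡m)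
open import Data.Nat.Properties using (*-cancelʳ-≡; *-cancelˡ-≡; *-suc; +-assoc; +-cancelˡ-≡; +-comm
  ; +-identityʳ; +-suc; <-trans; <-≤-trans; <ᵇ⇒<; <⇒<ᵇ; <⇒≢; <⇒≱; even≢odd; m<n+m; m≤m+n; m≤m⊔n
  ; m≤n+m; m≤n⇒m≤1+n; m≤n⇒∃[o]m+o≡n; m≤n⊔m; n<1+n; n≤1+n; ≡ᵇ⇒≡; ≡⇒≡ᵇ; ≤-<-trans; ≤-pred; ≤-refl
  ; ≤-reflexive; ≤-trans; ≤∧≢⇒<)
open import Data.Product using (_,_; _×_; proj₁; proj₂; Σ; ∃-syntax)
open import Data.Sum using (_⊎_; inj₁; inj₂)
open import Data.Unit using (tt; ⊤)
open import Function using (Equivalence; _⇔_; case_of_; mk⇔)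
open import Relation.Binary.Construct.Closure.ReflexiveTransitive using (Star; _◅_; _◅◅_; kleisliStar; ε)
open import Relation.Binary.PropositionalEquality using (_≗_; _≡_; _≢_; ≢-sym; cong; cong₂
  ; module ≡-Reasoning; refl; subst; sym; trans)
open import Relation.Nullary using (no; yes; ¬_)

-- Register machines

infix 4 _⊢_↝_ _⊢_↝*_

data _⊢_↝_ (P : Program) (c c' : MConf) : Set where
  step : mstep P c ≡ just c' → P ⊢ c ↝ c'

_⊢_↝*_ : Program → MConf → MConf → Set
P ⊢ c ↝* c' = Star (P ⊢_↝_) c c'

module _ {P : Program} {c : MConf} where

  ↝-inc : ∀ {r l} → nth P (pc c) ≡ just (inc r l) → P ⊢ c ↝ mconf l (update (regs c) r (suc (regs c r)))
  ↝-inc eq = step (mstep-inc eq)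
    where
    mstep-inc : ∀ {r l} → nth P (pc c) ≡ just (inc r l) →
                mstep P c ≡ just (mconf l (update (regs c) r (suc (regs c r))))
    mstep-inc eq with nth P (pc c) | eq
    ... | just (inc r l) | refl = refl

  ↝-dec-zero : ∀ {r l₁ l₂} → nth P (pc c) ≡ just (dec r l₁ l₂) → regs c r ≡ 0 → P ⊢ c ↝ mconf l₂ (regs c)
  ↝-dec-zero eq z = step (mstep-dec-zero eq z)
    where
    mstep-dec-zero : ∀ {r l₁ l₂} → nth P (pc c) ≡ just (dec r l₁ l₂) → regs c r ≡ 0 →
                     mstep P c ≡ just (mconf l₂ (regs c))
    mstep-dec-zero {r} eq z with nth P (pc c) | eq
    ... | just (dec r l₁ l₂) | refl with regs c r | z
    ...   | zero | refl = refl

  ↝-dec-suc : ∀ {r l₁ l₂ v} → nth P (pc c) ≡ just (dec r l₁ l₂) → regs c r ≡ suc v →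
              P ⊢ c ↝ mconf l₁ (update (regs c) r v)
  ↝-dec-suc eq s = step (mstep-dec-suc eq s)
    where
    mstep-dec-suc : ∀ {r l₁ l₂ v} → nth P (pc c) ≡ just (dec r l₁ l₂) → regs c r ≡ suc v →
                    mstep P c ≡ just (mconf l₁ (update (regs c) r v))
    mstep-dec-suc {r} eq s with nth P (pc c) | eq
    ... | just (dec r l₁ l₂) | refl with regs c r | s
    ...   | suc v | refl = refl

  halt-stuck : ∀ {c'} → nth P (pc c) ≡ just halt → ¬ P ⊢ c ↝ c'
  halt-stuck eq (step s) = case trans (sym (mstep-halt eq)) s of λ ()
    where
    mstep-halt : nth P (pc c) ≡ just halt → mstep P c ≡ nothing
    mstep-halt eq with nth P (pc c) | eq
    ... | just halt | refl = refl

exec⇒↝* : ∀ {P} n {c c'} → exec P n c ≡ just c' → P ⊢ c ↝* c'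
exec⇒↝* zero refl = ε
exec⇒↝* {P} (suc n) {c} eq with mstep P c in s
... | just c₁ = step s ◅ exec⇒↝* n eq

↝*-connex : ∀ {P c c₁ c₂} → P ⊢ c ↝* c₁ → P ⊢ c ↝* c₂ → P ⊢ c₁ ↝* c₂ ⊎ P ⊢ c₂ ↝* c₁
↝*-connex ε steps₂ = inj₁ steps₂
↝*-connex steps₁@(_ ◅ _) ε = inj₂ steps₁
↝*-connex (step s₁ ◅ steps₁) (step s₂ ◅ steps₂) with refl ← trans (sym s₁) s₂ = ↝*-connex steps₁ steps₂

update-same : ∀ f r v → update f r v r ≡ v
update-same f r v with r ≡ᵇ r | ≡⇒≡ᵇ r r refl
... | true | _ = refl

update-other : ∀ f r v {i} → i ≢ r → update f r v i ≡ f i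
update-other f r v {i} i≢r with i ≡ᵇ r | ≡ᵇ⇒≡ i r
... | false | _ = refl
... | true | i≡r = ⊥-elim (i≢r (i≡r _))

↝-deterministic : ∀ {P c c₁ c₂} → P ⊢ c ↝ c₁ → P ⊢ c ↝ c₂ → c₁ ≡ c₂
↝-deterministic (step s₁) (step s₂) with refl ← trans (sym s₁) s₂ = refl

outside-stuck : ∀ {P c c'} → nth P (pc c) ≡ nothing → ¬ P ⊢ c ↝ c'
outside-stuck {P} {c} eq (step s) = case trans (sym (mstep-outside eq)) s of λ ()
  where
  mstep-outside : nth P (pc c) ≡ nothing → mstep P c ≡ nothing
  mstep-outside eq with nth P (pc c) | eq
  ... | nothing | refl = refl

ReachesHalt : Program → ℕ → Set
ReachesHalt P x = ∃[ c ] P ⊢ start x ↝* c × nth P (pc c) ≡ just halt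

-- μStipula runs without the Σ component

Snapshot : Set
Snapshot = ℕ × PendingMS

infix 4 _⊢_⟶_

-- A move is a Function or Event-Match step together with the State-Change that has to follow it.
data _⊢_⟶_ (C : Contract) : Snapshot → Snapshot → Set where
  fire    : ∀ {Q Ψ} f → f ∈ funs C → from f ≡ Q → nored Ψ Q → C ⊢ (Q , Ψ) ⟶ (to f , body f ++ Ψ)
  trigger : ∀ {Q Q' n} Ψ₁ Ψ₂ → C ⊢ (Q , Ψ₁ ++ mkEvent 0 n Q Q' ∷ Ψ₂) ⟶ (Q' , Ψ₁ ++ Ψ₂)
  elapse  : ∀ {Q Ψ} → nored Ψ Q → C ⊢ (Q , Ψ) ⟶ (Q , tick Ψ)

_⊢_⟶*_ : Contract → Snapshot → Snapshot → Set
C ⊢ s ⟶* s' = Star (C ⊢_⟶_) s s'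

Reachable′ : Contract → ℕ → Set
Reachable′ C Q = ∃[ Ψ ] C ⊢ (init C , []) ⟶* (Q , Ψ)

snapshot : Config → Snapshot
snapshot ⟨ Q , nothing , Ψ ⟩ = Q , Ψ
snapshot ⟨ _ , just (Ψ' , Q') , Ψ ⟩ = Q' , Ψ' ++ Ψ

step⇒⟶* : ∀ {C c c'} → Step C c c' → C ⊢ snapshot c ⟶* snapshot c'
step⇒⟶* (function f f∈ eq nr) = fire f f∈ eq nr ◅ ε
step⇒⟶* stateChange = ε
step⇒⟶* (eventMatch {Ψ₁ = Ψ₁} {Ψ₂}) = trigger Ψ₁ Ψ₂ ◅ ε
step⇒⟶* (tickStep nr) = elapse nr ◅ ε

⟶⇒steps : ∀ {C Q Q' Ψ Ψ'} → C ⊢ (Q , Ψ) ⟶ (Q' , Ψ') →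
          Star (Step C) ⟨ Q , nothing , Ψ ⟩ ⟨ Q' , nothing , Ψ' ⟩
⟶⇒steps (fire f f∈ eq nr) = function f f∈ eq nr ◅ stateChange ◅ ε
⟶⇒steps (trigger Ψ₁ Ψ₂) = eventMatch ◅ stateChange ◅ ε
⟶⇒steps (elapse nr) = tickStep nr ◅ ε

reachable⇔reachable′ : ∀ {C Q} → Reachable C Q ⇔ Reachable′ C Q
reachable⇔reachable′ = mk⇔ (λ (Ψ , steps) → Ψ , kleisliStar snapshot step⇒⟶* steps)
                           (λ (Ψ , moves) → Ψ , kleisliStar (λ (Q , Ψ) → ⟨ Q , nothing , Ψ ⟩) ⟶⇒steps moves)

eraseLine : Event → Event
eraseLine e = mkEvent (time e) 0 (src e) (tgt e)

eraseLines : Fun → Fun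
eraseLines f = mkFun (from f) (map eraseLine (body f)) (to f)

_≈_ : PendingMS → PendingMS → Set
Ψ ≈ Φ = map eraseLine Ψ ≡ map eraseLine Φ

nored-≈ : ∀ {Ψ Φ Q} → Ψ ≈ Φ → nored Ψ Q → nored Φ Q
nored-≈ {Q = Q} Ψ≈Φ nr = All.map⁻ (subst (All (λ e → ¬ (time e ≡ 0 × src e ≡ Q))) Ψ≈Φ (All.map⁺ nr))

tick-eraseLine : ∀ Ψ → map eraseLine (tick Ψ) ≡ tick (map eraseLine Ψ)
tick-eraseLine [] = refl
tick-eraseLine (mkEvent zero n q₁ q₂ ∷ Ψ) = tick-eraseLine Ψ
tick-eraseLine (mkEvent (suc k) n q₁ q₂ ∷ Ψ) = cong (_ ∷_) (tick-eraseLine Ψ)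

map-≡-++-∷ : ∀ {A B : Set} (f : A → B) xs {ys y zs} → map f xs ≡ ys ++ y ∷ zs →
             ∃[ xs₁ ] ∃[ x ] ∃[ xs₂ ] xs ≡ xs₁ ++ x ∷ xs₂ × map f xs₁ ≡ ys × f x ≡ y × map f xs₂ ≡ zs
map-≡-++-∷ f (x ∷ xs) {[]} eq with refl , refl ← ∷-injective eq = [] , x , xs , refl , refl , refl , refl
map-≡-++-∷ f (x ∷ xs) {_ ∷ ys} eq with refl , eq' ← ∷-injective eq with map-≡-++-∷ f xs {ys} eq'
... | xs₁ , x' , xs₂ , refl , refl , refl , refl = x ∷ xs₁ , x' , xs₂ , refl , refl , refl , refl

SameUpToLines : Contract → Contract → Set
SameUpToLines C C' = init C ≡ init C' × map eraseLines (funs C) ≡ map eraseLines (funs C')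

⟶-transfer : ∀ {C C' Q Q' Ψ Ψ' Φ} → SameUpToLines C C' → C ⊢ (Q , Ψ) ⟶ (Q' , Φ) → Ψ ≈ Ψ' →
             ∃[ Φ' ] C' ⊢ (Q , Ψ') ⟶ (Q' , Φ') × Φ ≈ Φ'
⟶-transfer {C} {C'} {Ψ' = Ψ'} (_ , same) (fire f f∈ refl nr) Ψ≈Ψ'
  with f' , f'∈ , f≡f' ← ∈-map⁻ eraseLines (subst (eraseLines f ∈_) same (∈-map⁺ eraseLines f∈)) =
  body f' ++ Ψ' , fire′ f'∈ (cong from (sym f≡f')) (cong to f≡f') (nored-≈ Ψ≈Ψ' nr) ,
  trans (map-++ eraseLine (body f) _) (trans (cong₂ _++_ (cong body f≡f') Ψ≈Ψ') (sym (map-++ eraseLine (body f') Ψ')))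
  where
  fire′ : ∀ {f' Q Q'} → f' ∈ funs C' → from f' ≡ Q → Q' ≡ to f' → nored Ψ' Q → C' ⊢ (Q , Ψ') ⟶ (Q' , body f' ++ Ψ')
  fire′ f'∈ eq refl = fire _ f'∈ eq
⟶-transfer _ (trigger Ψ₁ Ψ₂) Ψ≈Ψ'
  with Ψ₁' , mkEvent _ _ _ _ , Ψ₂' , refl , Ψ₁≈ , refl , Ψ₂≈
         ← map-≡-++-∷ eraseLine _ (trans (sym Ψ≈Ψ') (map-++ eraseLine Ψ₁ _)) =
  Ψ₁' ++ Ψ₂' , trigger Ψ₁' Ψ₂' ,
  trans (map-++ eraseLine Ψ₁ Ψ₂) (trans (sym (cong₂ _++_ Ψ₁≈ Ψ₂≈)) (sym (map-++ eraseLine Ψ₁' Ψ₂')))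
⟶-transfer {Ψ = Ψ} {Ψ'} _ (elapse nr) Ψ≈Ψ' =
  tick Ψ' , elapse (nored-≈ Ψ≈Ψ' nr) ,
  trans (tick-eraseLine Ψ) (trans (cong tick Ψ≈Ψ') (sym (tick-eraseLine Ψ')))

⟶*-transfer : ∀ {C C' Q Q' Ψ Ψ' Φ} → SameUpToLines C C' → C ⊢ (Q , Ψ) ⟶* (Q' , Φ) → Ψ ≈ Ψ' →
              ∃[ Φ' ] C' ⊢ (Q , Ψ') ⟶* (Q' , Φ')
⟶*-transfer {Ψ' = Ψ'} same ε Ψ≈Ψ' = Ψ' , ε
⟶*-transfer same (move ◅ moves) Ψ≈Ψ' with Φ' , move' , Φ≈Φ' ← ⟶-transfer same move Ψ≈Ψ'
                                      with Φ″ , moves' ← ⟶*-transfer same moves Φ≈Φ' = Φ″ , move' ◅ moves'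

sameUpToLines-sym : ∀ {C C'} → SameUpToLines C C' → SameUpToLines C' C
sameUpToLines-sym (init≡ , funs≡) = sym init≡ , sym funs≡

reachable′-transfer : ∀ {C C' Q} → SameUpToLines C C' → Reachable′ C Q → Reachable′ C' Q
reachable′-transfer same@(refl , _) (_ , moves) = ⟶*-transfer same moves refl

quiet-⟶ : ∀ {C X Ψ Q' Ψ'} → All (λ e → src e ≢ X) Ψ → C ⊢ (X , Ψ) ⟶ (Q' , Ψ') →
          (∃[ f ] f ∈ funs C × from f ≡ X × Q' ≡ to f × Ψ' ≡ body f ++ Ψ) ⊎ (Q' ≡ X × Ψ' ≡ tick Ψ)
quiet-⟶ _ (fire f f∈ eq _) = inj₁ (f , f∈ , eq , refl , refl)
quiet-⟶ quiet (trigger Ψ₁ Ψ₂) = ⊥-elim (All.lookup quiet (∈-++⁺ʳ Ψ₁ (here refl)) refl)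
quiet-⟶ _ (elapse _) = inj₂ (refl , refl)

pending-⟶ : ∀ {C X Y Ψ Φ Q' Ψ'} → Ψ ↭ mkEvent 0 0 X Y ∷ Φ → All (λ e → src e ≡ X → e ≡ mkEvent 0 0 X Y) Φ →
            C ⊢ (X , Ψ) ⟶ (Q' , Ψ') → (Q' ≡ Y × Ψ' ↭ Φ) ⊎ (Q' ≡ X × Ψ' ≡ tick Ψ)
pending-⟶ Ψ↭ _ (fire _ _ _ nr) = ⊥-elim (All.lookup nr (∈-resp-↭ (↭-sym Ψ↭) (here refl)) (refl , refl))
pending-⟶ Ψ↭ unique (trigger Ψ₁ Ψ₂) with ∈-resp-↭ Ψ↭ (∈-++⁺ʳ Ψ₁ (here refl))
... | here refl = inj₁ (refl , drop-∷ (↭-trans (↭-sym (shift _ Ψ₁ Ψ₂)) Ψ↭))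
... | there e∈Φ with refl ← All.lookup unique e∈Φ refl = inj₁ (refl , drop-∷ (↭-trans (↭-sym (shift _ Ψ₁ Ψ₂)) Ψ↭))
pending-⟶ _ _ (elapse _) = inj₂ (refl , refl)

trigger-↭ : ∀ {C X Y Ψ Φ} → Ψ ↭ mkEvent 0 0 X Y ∷ Φ → ∃[ Ψ' ] C ⊢ (X , Ψ) ⟶ (Y , Ψ') × Ψ' ↭ Φ
trigger-↭ Ψ↭ with Ψ₁ , Ψ₂ , refl ← ∈-∃++ (∈-resp-↭ (↭-sym Ψ↭) (here refl)) =
  Ψ₁ ++ Ψ₂ , trigger Ψ₁ Ψ₂ , drop-∷ (↭-trans (↭-sym (shift _ Ψ₁ Ψ₂)) Ψ↭)

quiet⇒nored : ∀ {Ψ X} → All (λ e → src e ≢ X) Ψ → nored Ψ X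
quiet⇒nored = All.map (λ src≢X (_ , src≡X) → src≢X src≡X)

tick-instant : ∀ {Ψ} → All (λ e → time e ≡ 0) Ψ → tick Ψ ≡ []
tick-instant {[]} [] = refl
tick-instant {mkEvent zero _ _ _ ∷ Ψ} (_ ∷ inst) = tick-instant inst

tick-All : ∀ {P : ℕ → Set} Ψ → All (λ e → P (tgt e)) Ψ → All (λ e → P (tgt e)) (tick Ψ)
tick-All [] [] = []
tick-All (mkEvent zero _ _ _ ∷ Ψ) (_ ∷ ps) = tick-All Ψ ps
tick-All (mkEvent (suc _) _ _ _ ∷ Ψ) (p ∷ ps) = p ∷ tick-All Ψ ps

-- The contract simulating a register machine

data Branch : Set where
  full empty : Branch

flip : Branch → Branch
flip full = empty
flip empty = full

exit : Branch → ℕ → ℕ → ℕ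
exit full l₁ l₂ = l₁
exit empty l₁ l₂ = l₂

data Node : Set where
  initial final halted : Node
  at probe : ℕ → Node
  gate handler : Branch → ℕ → Node

tag : Node → Fin 9
tag initial = # 0
tag final = # 1
tag halted = # 2
tag (at _) = # 3
tag (probe _) = # 4
tag (gate full _) = # 5
tag (gate empty _) = # 6
tag (handler full _) = # 7
tag (handler empty _) = # 8

index : Node → ℕ
index (at i) = i
index (probe r) = r
index (gate _ r) = r
index (handler _ i) = i
index _ = 0

untag : ℕ → ℕ → Node
untag 0 _ = initial
untag 1 _ = final
untag 2 _ = halted
untag 3 i = at i
untag 4 i = probe i
untag 5 i = gate full i
untag 6 i = gate empty i
untag 7 i = handler full i
untag _ i = handler empty i

untag-tag : ∀ ν → untag (toℕ (tag ν)) (index ν) ≡ ν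
untag-tag initial = refl
untag-tag final = refl
untag-tag halted = refl
untag-tag (at _) = refl
untag-tag (probe _) = refl
untag-tag (gate full _) = refl
untag-tag (gate empty _) = refl
untag-tag (handler full _) = refl
untag-tag (handler empty _) = refl

⌜_⌝ : Node → ℕ
⌜ ν ⌝ = toℕ (tag ν) + index ν * 9

tag≡⌜⌝%9 : ∀ ν → toℕ (tag ν) ≡ ⌜ ν ⌝ % 9
tag≡⌜⌝%9 ν = sym (trans ([m+kn]%n≡m%n (toℕ (tag ν)) (index ν) 9) (m<n⇒m%n≡m (toℕ<n (tag ν))))

⌜⌝-injective : ∀ {ν μ} → ⌜ ν ⌝ ≡ ⌜ μ ⌝ → ν ≡ μ
⌜⌝-injective {ν} {μ} eq = begin
  ν                          ≡⟨ sym (untag-tag ν) ⟩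
  untag (toℕ (tag ν)) (index ν)    ≡⟨ cong₂ untag tags indices ⟩
  untag (toℕ (tag μ)) (index μ)    ≡⟨ untag-tag μ ⟩
  μ                          ∎
  where
  open ≡-Reasoning
  tags : toℕ (tag ν) ≡ toℕ (tag μ)
  tags = trans (tag≡⌜⌝%9 ν) (trans (cong (_% 9) eq) (sym (tag≡⌜⌝%9 μ)))
  indices : index ν ≡ index μ
  indices = *-cancelʳ-≡ (index ν) (index μ) 9 (+-cancelˡ-≡ (toℕ (tag ν)) _ _ (trans eq (cong (_+ index μ * 9) (sym tags))))

infix 5 _⇒_

_⇒_ : Node → Node → Event
ν ⇒ μ = mkEvent 0 0 ⌜ ν ⌝ ⌜ μ ⌝

fn : Node → List Event → Node → Fun
fn ν W μ = mkFun ⌜ ν ⌝ W ⌜ μ ⌝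

unit : ℕ → Event
unit r = probe r ⇒ gate full r

sentinel : Event
sentinel = halted ⇒ final

ret : Branch → ℕ → ℕ → Event
ret b i r = gate b r ⇒ handler b i

mark : Branch → ℕ → ℕ → Event
mark b i l = handler b i ⇒ at l

atFun : ℕ → Instr → Fun
atFun i (inc r l) = fn (at i) [ unit r ] (at l)
atFun i (dec r l₁ l₂) = fn (at i) (ret full i r ∷ ret empty i r ∷ []) (probe r)
atFun i halt = fn (at i) [] halted

probeFun : ℕ → Fun
probeFun r = fn (probe r) [] (gate empty r)

-- Both return events of a decrement are consumed, in the order fixed by the branch taken. The
-- handler reached first leaves a mark for the other one, which blocks the other handler's function
-- and leads to the exit of the branch taken.
handlerFun : Branch → ℕ → ℕ → ℕ → ℕ → Fun
handlerFun b i r l₁ l₂ = fn (handler b i) [ mark (flip b) i (exit b l₁ l₂) ] (gate (flip b) r)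

instrFuns : ℕ → Instr → List Fun
instrFuns i (inc r l) = [ atFun i (inc r l) ]
instrFuns i (dec r l₁ l₂) =
  atFun i (dec r l₁ l₂) ∷ probeFun r ∷ handlerFun full i r l₁ l₂ ∷ handlerFun empty i r l₁ l₂ ∷ []
instrFuns i halt = [ atFun i halt ]

machineFuns : ℕ → Program → List Fun
machineFuns i [] = []
machineFuns i (x ∷ P) = instrFuns i x ++ machineFuns (suc i) P

-- The simulation is carried out on this copy of the contract, in which every line index is 0.
loadFun₀ : ℕ → Fun
loadFun₀ E = fn initial (replicate E (unit 0) ++ [ sentinel ]) (at 0)

machineContract₀ : Program → ℕ → Contract
machineContract₀ P E = mkContract ⌜ initial ⌝ (loadFun₀ E ∷ machineFuns 0 P)

-- The loader gets the even lines 2E, …, 2, 0 and all other events odd lines, so that the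
-- functions other than the loader, and hence their code, do not depend on E.
loadBody : ℕ → List Event
loadBody zero = [ sentinel ]
loadBody (suc n) = record (unit 0) { line = 2 * suc n } ∷ loadBody n

loadFun : ℕ → Fun
loadFun E = mkFun ⌜ initial ⌝ (loadBody E) ⌜ at 0 ⌝

numberEvents : ℕ → List Event → List Event
numberEvents k [] = []
numberEvents k (e ∷ es) = record e { line = suc (2 * k) } ∷ numberEvents (suc k) es

numberFuns : ℕ → List Fun → List Fun
numberFuns k [] = []
numberFuns k (f ∷ fs) = record f { body = numberEvents k (body f) } ∷ numberFuns (k + length (body f)) fs

machineContract : Program → ℕ → Contract
machineContract P E = mkContract ⌜ initial ⌝ (loadFun E ∷ numberFuns 0 (machineFuns 0 P))

numberEvents-eraseLine : ∀ k es → map eraseLine (numberEvents k es) ≡ map eraseLine es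
numberEvents-eraseLine k [] = refl
numberEvents-eraseLine k (e ∷ es) = cong (eraseLine e ∷_) (numberEvents-eraseLine (suc k) es)

numberFuns-eraseLines : ∀ k fs → map eraseLines (numberFuns k fs) ≡ map eraseLines fs
numberFuns-eraseLines k [] = refl
numberFuns-eraseLines k (f ∷ fs) =
  cong₂ _∷_ (cong (λ W → mkFun (from f) W (to f)) (numberEvents-eraseLine k (body f)))
            (numberFuns-eraseLines (k + length (body f)) fs)

loadBody-eraseLine : ∀ E → map eraseLine (loadBody E) ≡ map eraseLine (replicate E (unit 0) ++ [ sentinel ])
loadBody-eraseLine zero = refl
loadBody-eraseLine (suc E) = cong (unit 0 ∷_) (loadBody-eraseLine E)

machineContract-sameUpToLines : ∀ P E → SameUpToLines (machineContract P E) (machineContract₀ P E)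
machineContract-sameUpToLines P E =
  refl , cong₂ _∷_ (cong (λ W → mkFun ⌜ initial ⌝ W ⌜ at 0 ⌝) (loadBody-eraseLine E))
                   (numberFuns-eraseLines 0 (machineFuns 0 P))

InstantFun : Fun → Set
InstantFun f = All (λ e → time e ≡ 0) (body f)

machineFuns-instant : ∀ i P → All InstantFun (machineFuns i P)
machineFuns-instant i [] = []
machineFuns-instant i (inc r l ∷ P) = (refl ∷ []) ∷ machineFuns-instant (suc i) P
machineFuns-instant i (dec r l₁ l₂ ∷ P) =
  (refl ∷ refl ∷ []) ∷ [] ∷ (refl ∷ []) ∷ (refl ∷ []) ∷ machineFuns-instant (suc i) P
machineFuns-instant i (halt ∷ P) = [] ∷ machineFuns-instant (suc i) P

numberFuns-instant : ∀ k fs → All InstantFun fs → All InstantFun (numberFuns k fs)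
numberFuns-instant k [] [] = []
numberFuns-instant k (f ∷ fs) (inst ∷ insts) = events k (body f) inst ∷ numberFuns-instant _ fs insts
  where
  events : ∀ k es → All (λ e → time e ≡ 0) es → All (λ e → time e ≡ 0) (numberEvents k es)
  events k [] [] = []
  events k (e ∷ es) (t ∷ ts) = t ∷ events (suc k) es ts

loadBody-instant : ∀ E → InstantFun (loadFun E)
loadBody-instant zero = refl ∷ []
loadBody-instant (suc E) = refl ∷ loadBody-instant E

concatMap-body-instant : ∀ fs → All InstantFun fs → All (λ e → time e ≡ 0) (concatMap body fs)
concatMap-body-instant [] [] = []
concatMap-body-instant (f ∷ fs) (inst ∷ insts) = All.++⁺ inst (concatMap-body-instant fs insts)

machineContract-instantaneous : ∀ P E → Instantaneous (machineContract P E)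
machineContract-instantaneous P E =
  concatMap-body-instant (loadFun E ∷ _) (loadBody-instant E ∷ numberFuns-instant 0 _ (machineFuns-instant 0 P))

loadBody-lines : ∀ E → map line (loadBody E) ≡ map (2 *_) (downFrom (suc E))
loadBody-lines zero = refl
loadBody-lines (suc E) = cong (2 * suc E ∷_) (loadBody-lines E)

Linked-weakenʰ : ∀ {x y xs} → y ≤ x → Linked _<_ (x ∷ xs) → Linked _<_ (y ∷ xs)
Linked-weakenʰ y≤x [-] = [-]
Linked-weakenʰ y≤x (x<z ∷ linked) = ≤-<-trans y≤x x<z ∷ linked

numberEvents-linked : ∀ k es ys → Linked _<_ (2 * (k + length es) ∷ ys) →
                      Linked _<_ (2 * k ∷ map line (numberEvents k es) ++ ys)
numberEvents-linked k [] ys linked = subst (λ m → Linked _<_ (2 * m ∷ ys)) (+-identityʳ k) linked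
numberEvents-linked k (e ∷ es) ys linked =
  n<1+n (2 * k) ∷ Linked-weakenʰ (≤-trans (n≤1+n _) (≤-reflexive (sym (*-suc 2 k))))
                    (numberEvents-linked (suc k) es ys (subst (λ m → Linked _<_ (2 * m ∷ ys)) (+-suc k (length es)) linked))

numberFuns-linked : ∀ k fs → Linked _<_ (2 * k ∷ map line (concatMap body (numberFuns k fs)))
numberFuns-linked k [] = [-]
numberFuns-linked k (f ∷ fs)
  rewrite map-++ line (numberEvents k (body f)) (concatMap body (numberFuns (k + length (body f)) fs)) =
  numberEvents-linked k (body f) _ (numberFuns-linked (k + length (body f)) fs)

Odd : ℕ → Set
Odd n = ∃[ j ] n ≡ suc (2 * j)

numberFuns-odd : ∀ k fs → All Odd (map line (concatMap body (numberFuns k fs)))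
numberFuns-odd k [] = []
numberFuns-odd k (f ∷ fs)
  rewrite map-++ line (numberEvents k (body f)) (concatMap body (numberFuns (k + length (body f)) fs)) =
  All.++⁺ (events k (body f)) (numberFuns-odd (k + length (body f)) fs)
  where
  events : ∀ k es → All Odd (map line (numberEvents k es))
  events k [] = []
  events k (e ∷ es) = (k , refl) ∷ events (suc k) es

machineContract-wellFormed : ∀ P E → WellFormed (machineContract P E)
machineContract-wellFormed P E
  rewrite map-++ line (loadBody E) (concatMap body (numberFuns 0 (machineFuns 0 P))) =
  Unique.++⁺ evens odds λ (v∈evens , v∈odds) → disjoint v∈evens (All.lookup (numberFuns-odd 0 (machineFuns 0 P)) v∈odds)
  where
  evens : Unique (map line (loadBody E))
  evens rewrite loadBody-lines E = Unique.map⁺ (λ {x} {y} → *-cancelˡ-≡ x y 2) (Unique.downFrom⁺ (suc E))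
  odds : Unique (map line (concatMap body (numberFuns 0 (machineFuns 0 P))))
  odds with _ ∷ ascending ← Linked⇒AllPairs <-trans (numberFuns-linked 0 (machineFuns 0 P)) =
    AllPairs.map <⇒≢ ascending
  disjoint : ∀ {v} → v ∈ map line (loadBody E) → Odd v → ⊥
  disjoint v∈evens (j , refl) rewrite loadBody-lines E
    with m , _ , eq ← ∈-map⁻ (2 *_) {xs = downFrom (suc E)} v∈evens = even≢odd m j (sym eq)

FunAt : Node → ℕ → Instr → Fun → Set
FunAt (at j) i x f = j ≡ i × f ≡ atFun i x
FunAt (probe r) i x f = f ≡ probeFun r
FunAt (handler b j) i x f = j ≡ i × ∃[ r ] ∃[ l₁ ] ∃[ l₂ ] x ≡ dec r l₁ l₂ × f ≡ handlerFun b i r l₁ l₂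
FunAt _ i x f = ⊥

instrFuns-from : ∀ {ν i x f} → f ∈ instrFuns i x → from f ≡ ⌜ ν ⌝ → FunAt ν i x f
instrFuns-from {ν} {i} {inc _ _} (here refl) eq with refl ← ⌜⌝-injective {at i} {ν} eq = refl , refl
instrFuns-from {ν} {i} {halt} (here refl) eq with refl ← ⌜⌝-injective {at i} {ν} eq = refl , refl
instrFuns-from {ν} {i} {dec r _ _} (here refl) eq with refl ← ⌜⌝-injective {at i} {ν} eq = refl , refl
instrFuns-from {ν} {i} {dec r _ _} (there (here refl)) eq with refl ← ⌜⌝-injective {probe r} {ν} eq = refl
instrFuns-from {ν} {i} {dec r _ _} (there (there (here refl))) eq
  with refl ← ⌜⌝-injective {handler full i} {ν} eq = refl , _ , _ , _ , refl , refl
instrFuns-from {ν} {i} {dec r _ _} (there (there (there (here refl)))) eq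
  with refl ← ⌜⌝-injective {handler empty i} {ν} eq = refl , _ , _ , _ , refl , refl

∈-machineFuns : ∀ k P {f} → f ∈ machineFuns k P → ∃[ j ] ∃[ x ] nth P j ≡ just x × f ∈ instrFuns (k + j) x
∈-machineFuns k (x ∷ P) {f} f∈ with ∈-++⁻ (instrFuns k x) f∈
... | inj₁ f∈x = 0 , x , refl , subst (λ i → f ∈ instrFuns i x) (sym (+-identityʳ k)) f∈x
... | inj₂ f∈P with j , y , eq , f∈y ← ∈-machineFuns (suc k) P f∈P =
  suc j , y , eq , subst (λ i → f ∈ instrFuns i y) (sym (+-suc k j)) f∈y

machineFuns-∈ : ∀ k P {j x f} → nth P j ≡ just x → f ∈ instrFuns (k + j) x → f ∈ machineFuns k P
machineFuns-∈ k (y ∷ P) {zero} {x} {f} refl f∈ = ∈-++⁺ˡ (subst (λ i → f ∈ instrFuns i x) (+-identityʳ k) f∈)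
machineFuns-∈ k (y ∷ P) {suc j} {x} {f} eq f∈ =
  ∈-++⁺ʳ (instrFuns k y) (machineFuns-∈ (suc k) P eq (subst (λ i → f ∈ instrFuns i x) (+-suc k j) f∈))

-- Correctness of the simulation

maxRegister : Program → ℕ
maxRegister [] = 0
maxRegister (inc r _ ∷ P) = r ⊔ maxRegister P
maxRegister (dec r _ _ ∷ P) = r ⊔ maxRegister P
maxRegister (halt ∷ P) = maxRegister P

RegistersAtMost : ℕ → Instr → Set
RegistersAtMost m (inc r _) = r ≤ m
RegistersAtMost m (dec r _ _) = r ≤ m
RegistersAtMost m halt = ⊤

RegistersAtMost-mono : ∀ {m m'} x → m ≤ m' → RegistersAtMost m x → RegistersAtMost m' x
RegistersAtMost-mono (inc _ _) m≤m' r≤m = ≤-trans r≤m m≤m'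
RegistersAtMost-mono (dec _ _ _) m≤m' r≤m = ≤-trans r≤m m≤m'
RegistersAtMost-mono halt _ _ = tt

nth-maxRegister : ∀ P {i x} → nth P i ≡ just x → RegistersAtMost (maxRegister P) x
nth-maxRegister (inc r _ ∷ P) {zero} refl = m≤m⊔n r _
nth-maxRegister (dec r _ _ ∷ P) {zero} refl = m≤m⊔n r _
nth-maxRegister (halt ∷ P) {zero} refl = tt
nth-maxRegister (inc r _ ∷ P) {suc i} {x} eq = RegistersAtMost-mono x (m≤n⊔m r _) (nth-maxRegister P eq)
nth-maxRegister (dec r _ _ ∷ P) {suc i} {x} eq = RegistersAtMost-mono x (m≤n⊔m r _) (nth-maxRegister P eq)
nth-maxRegister (halt ∷ P) {suc i} eq = nth-maxRegister P eq

regTokens : (ℕ → ℕ) → ℕ → List Event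
regTokens ρ zero = []
regTokens ρ (suc r) = replicate (ρ r) (unit r) ++ regTokens ρ r

regTokens-cong : ∀ n {ρ σ} → (∀ r → r < n → ρ r ≡ σ r) → regTokens ρ n ≡ regTokens σ n
regTokens-cong zero _ = refl
regTokens-cong (suc m) ρ≡σ =
  cong₂ (λ k → replicate k (unit m) ++_) (ρ≡σ m ≤-refl) (regTokens-cong m λ r r<m → ρ≡σ r (≤-trans r<m (n≤1+n m)))

regTokens-unit : ∀ n {r ρ σ} → r < n → σ r ≡ suc (ρ r) → (∀ s → s ≢ r → σ s ≡ ρ s) →
                 regTokens σ n ↭ unit r ∷ regTokens ρ n
regTokens-unit (suc m) {r} {ρ} {σ} r<n σr≡ σs≡ with m ≟ r
... | yes refl rewrite σr≡ =
  prep (unit r) (↭-reflexive (cong (replicate (ρ r) (unit r) ++_)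
                               (regTokens-cong r λ s s<r → σs≡ s (<⇒≢ s<r))))
... | no m≢r rewrite σs≡ m m≢r =
  ↭-trans (++⁺ˡ (replicate (ρ m) (unit m))
                 (regTokens-unit m (≤∧≢⇒< (≤-pred r<n) (λ r≡m → m≢r (sym r≡m))) σr≡ σs≡))
          (shift (unit r) (replicate (ρ m) (unit m)) _)

∈-replicate : ∀ k {x y : Event} → x ∈ replicate k y → x ≡ y × k ≢ 0
∈-replicate (suc k) (here refl) = refl , λ ()
∈-replicate (suc k) (there x∈) = proj₁ (∈-replicate k x∈) , λ ()

∈-regTokens : ∀ n {ρ e} → e ∈ regTokens ρ n → ∃[ r ] e ≡ unit r × ρ r ≢ 0
∈-regTokens (suc m) {ρ} e∈ with ∈-++⁻ (replicate (ρ m) (unit m)) e∈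
... | inj₁ e∈units = m , ∈-replicate (ρ m) e∈units
... | inj₂ e∈rest = ∈-regTokens m e∈rest

regTokens-start : ∀ m E → regTokens (regs (start E)) (suc m) ≡ replicate E (unit 0)
regTokens-start zero E = ++-identityʳ (replicate E (unit 0))
regTokens-start (suc m) E = regTokens-start m E

Safe : ℕ → Set
Safe Q = Q ≢ ⌜ initial ⌝ × Q ≢ ⌜ final ⌝

Inner : Node → Set
Inner initial = ⊥
Inner final = ⊥
Inner _ = ⊤

safe : ∀ ν {_ : Inner ν} → Safe ⌜ ν ⌝
safe ν {inner} = (λ eq → subst Inner (⌜⌝-injective {ν} {initial} eq) inner) ,
                 (λ eq → subst Inner (⌜⌝-injective {ν} {final} eq) inner)

SafeFun : Fun → Set
SafeFun f = Safe (to f) × All (λ e → Safe (tgt e)) (body f)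

machineFuns-safe : ∀ k P → All SafeFun (machineFuns k P)
machineFuns-safe k [] = []
machineFuns-safe k (inc r l ∷ P) = (safe (at l) , safe (gate full r) ∷ []) ∷ machineFuns-safe (suc k) P
machineFuns-safe k (dec r l₁ l₂ ∷ P) =
  (safe (probe r) , safe (handler full k) ∷ safe (handler empty k) ∷ []) ∷
  (safe (gate empty r) , []) ∷
  (safe (gate empty r) , safe (at l₁) ∷ []) ∷
  (safe (gate full r) , safe (at l₂) ∷ []) ∷ machineFuns-safe (suc k) P
machineFuns-safe k (halt ∷ P) = (safe halted , []) ∷ machineFuns-safe (suc k) P

gate-flip : ∀ b r → ⌜ gate (flip b) r ⌝ ≢ ⌜ gate b r ⌝
gate-flip full r eq with () ← ⌜⌝-injective {gate empty r} {gate full r} eq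
gate-flip empty r eq with () ← ⌜⌝-injective {gate full r} {gate empty r} eq

onlyFrom : ∀ {X T} e → All (λ e' → src e' ≢ X) T → All (λ e' → src e' ≡ X → e' ≡ e) T
onlyFrom e = All.map (λ src≢X src≡X → ⊥-elim (src≢X src≡X))

module Simulation (P : Program) (E : ℕ) where

  C₀ : Contract
  C₀ = machineContract₀ P E

  n : ℕ
  n = suc (maxRegister P)

  base : (ℕ → ℕ) → PendingMS
  base ρ = sentinel ∷ regTokens ρ n

  Reach : MConf → Set
  Reach c = P ⊢ start E ↝* c

  reach-step : ∀ {c c'} → Reach c → P ⊢ c ↝ c' → Reach c'
  reach-step reach s = reach ◅◅ s ◅ ε

  record Handshake (b : Branch) (i r : ℕ) (c' : MConf) : Set where
    constructor handshake
    field
      {l₁ l₂} : ℕ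
      instr   : nth P i ≡ just (dec r l₁ l₂)
      target  : pc c' ≡ exit b l₁ l₂
      reach   : Reach c'

  -- stage₁ … stage₄ are the moves after the zero test of a decrement at i on register r, b being the
  -- branch taken and c' the machine configuration that follows.
  data Canonical : Snapshot → Set where
    loading : Canonical (⌜ initial ⌝ , [])
    running : ∀ {i ρ Ψ} → Reach (mconf i ρ) → Ψ ↭ base ρ → Canonical (⌜ at i ⌝ , Ψ)
    probing : ∀ {i ρ r l₁ l₂ Ψ} → Reach (mconf i ρ) → nth P i ≡ just (dec r l₁ l₂) →
              Ψ ↭ ret full i r ∷ ret empty i r ∷ base ρ → Canonical (⌜ probe r ⌝ , Ψ)
    stage₁  : ∀ {b i r c' Ψ} → Handshake b i r c' →
              Ψ ↭ ret b i r ∷ ret (flip b) i r ∷ base (regs c') → Canonical (⌜ gate b r ⌝ , Ψ)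
    stage₂  : ∀ {b i r c' Ψ} → Handshake b i r c' →
              Ψ ↭ ret (flip b) i r ∷ base (regs c') → Canonical (⌜ handler b i ⌝ , Ψ)
    stage₃  : ∀ {b i r c' Ψ} → Handshake b i r c' →
              Ψ ↭ mark (flip b) i (pc c') ∷ ret (flip b) i r ∷ base (regs c') → Canonical (⌜ gate (flip b) r ⌝ , Ψ)
    stage₄  : ∀ {b i r c' Ψ} → Handshake b i r c' →
              Ψ ↭ mark (flip b) i (pc c') ∷ base (regs c') → Canonical (⌜ handler (flip b) i ⌝ , Ψ)

  -- What remains once a Tick has erased the sentinel: final is out of reach from here.
  Dead : Snapshot → Set
  Dead (Q , Ψ) = Safe Q × All (λ e → Safe (tgt e)) Ψ

  Invariant : Snapshot → Set
  Invariant s = Canonical s ⊎ Dead s ⊎ ReachesHalt P E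

  below : ∀ {i x} → nth P i ≡ just x → RegistersAtMost (maxRegister P) x
  below = nth-maxRegister P

  data BaseEvent (ρ : ℕ → ℕ) : Event → Node → Set where
    sentinel-event : BaseEvent ρ sentinel halted
    unit-event     : ∀ {r} → ρ r ≢ 0 → BaseEvent ρ (unit r) (probe r)

  base-from : ∀ {ρ e ν} → e ∈ base ρ → src e ≡ ⌜ ν ⌝ → BaseEvent ρ e ν
  base-from {ν = ν} (here refl) eq with refl ← ⌜⌝-injective {halted} {ν} eq = sentinel-event
  base-from {ν = ν} (there e∈) eq with r , refl , ρr≢0 ← ∈-regTokens n e∈
                                  with refl ← ⌜⌝-injective {probe r} {ν} eq = unit-event ρr≢0

  base-quiet : ∀ ρ {ν} → ν ≢ halted → (∀ {r} → ν ≢ probe r) → All (λ e → src e ≢ ⌜ ν ⌝) (base ρ)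
  base-quiet ρ {ν} ν≢halted ν≢probe = All.tabulate λ e∈ eq → impossible (base-from e∈ eq)
    where
    impossible : ∀ {e} → BaseEvent ρ e ν → ⊥
    impossible sentinel-event = ν≢halted refl
    impossible (unit-event _) = ν≢probe refl

  base-quiet-probe : ∀ ρ {r} → ρ r ≡ 0 → All (λ e → src e ≢ ⌜ probe r ⌝) (base ρ)
  base-quiet-probe ρ {r} ρr≡0 = All.tabulate λ e∈ eq → impossible (base-from e∈ eq)
    where
    impossible : ∀ {e} → BaseEvent ρ e (probe r) → ⊥
    impossible (unit-event ρr≢0) = ρr≢0 ρr≡0

  base-unit : ∀ ρ {r} → All (λ e → src e ≡ ⌜ probe r ⌝ → e ≡ unit r) (base ρ)
  base-unit ρ {r} = All.tabulate λ e∈ eq → is-unit (base-from e∈ eq)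
    where
    is-unit : ∀ {e} → BaseEvent ρ e (probe r) → e ≡ unit r
    is-unit (unit-event _) = refl

  base-instant : ∀ ρ → All (λ e → time e ≡ 0) (base ρ)
  base-instant ρ = refl ∷ All.tabulate λ e∈ → instant (∈-regTokens n e∈)
    where
    instant : ∀ {e} → ∃[ r ] e ≡ unit r × ρ r ≢ 0 → time e ≡ 0
    instant (_ , refl , _) = refl

  elapsed : ∀ ν {_ : Inner ν} {Ψ T} → Ψ ↭ T → All (λ e → time e ≡ 0) T → Invariant (⌜ ν ⌝ , tick Ψ)
  elapsed ν {inner} Ψ↭T instant rewrite tick-instant (All-resp-↭ (↭-sym Ψ↭T) instant) =
    inj₂ (inj₁ (safe ν {inner} , []))

  fun-from : ∀ {f} ν {_ : Inner ν} → f ∈ funs C₀ → from f ≡ ⌜ ν ⌝ → ∃[ j ] ∃[ x ] nth P j ≡ just x × FunAt ν j x f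
  fun-from ν {inner} (here refl) eq = ⊥-elim (subst Inner (⌜⌝-injective {ν} {initial} (sym eq)) inner)
  fun-from ν (there f∈) eq with j , x , nth≡ , f∈x ← ∈-machineFuns 0 P f∈ = j , x , nth≡ , instrFuns-from f∈x eq

  base-unit-↭ : ∀ {r ρ σ} → r ≤ maxRegister P → σ r ≡ suc (ρ r) → (∀ s → s ≢ r → σ s ≡ ρ s) →
                base σ ↭ unit r ∷ base ρ
  base-unit-↭ r≤max σr≡ σs≡ = ↭-trans (prep sentinel (regTokens-unit n (s≤s r≤max) σr≡ σs≡)) (swap _ _ ↭-refl)

  base-inc-↭ : ∀ {r} ρ → r ≤ maxRegister P → base (update ρ r (suc (ρ r))) ↭ unit r ∷ base ρ
  base-inc-↭ {r} ρ r≤max = base-unit-↭ r≤max (update-same ρ r _) (λ s s≢r → update-other ρ r _ s≢r)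

  base-dec-↭ : ∀ {r v} ρ → r ≤ maxRegister P → ρ r ≡ suc v → base ρ ↭ unit r ∷ base (update ρ r v)
  base-dec-↭ {r} {v} ρ r≤max ρr≡ =
    base-unit-↭ r≤max (trans ρr≡ (cong suc (sym (update-same ρ r v)))) (λ s s≢r → sym (update-other ρ r v s≢r))

  loaded : (replicate E (unit 0) ++ [ sentinel ]) ++ [] ↭ base (regs (start E))
  loaded rewrite ++-identityʳ (replicate E (unit 0) ++ [ sentinel ]) | regTokens-start (maxRegister P) E =
    ++-comm (replicate E (unit 0)) [ sentinel ]

  loading-⟶ : ∀ {Q' Ψ'} → C₀ ⊢ (⌜ initial ⌝ , []) ⟶ (Q' , Ψ') → Invariant (Q' , Ψ')
  loading-⟶ move with quiet-⟶ [] move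
  ... | inj₂ (refl , refl) = inj₁ loading
  ... | inj₁ (_ , here refl , _ , refl , refl) = inj₁ (running ε loaded)
  ... | inj₁ (_ , there f∈ , eq , refl , refl) with _ , _ , _ , f∈x ← ∈-machineFuns 0 P f∈ =
    ⊥-elim (instrFuns-from {initial} f∈x eq)

  running-⟶ : ∀ {i ρ Ψ Q' Ψ'} → Reach (mconf i ρ) → Ψ ↭ base ρ → C₀ ⊢ (⌜ at i ⌝ , Ψ) ⟶ (Q' , Ψ') →
              Invariant (Q' , Ψ')
  running-⟶ {i} {ρ} {Ψ} reach Ψ↭ move with quiet-⟶ (All-resp-↭ (↭-sym Ψ↭) (base-quiet ρ {at i} (λ ()) (λ ()))) move
  ... | inj₂ (refl , refl) = elapsed (at i) Ψ↭ (base-instant ρ)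
  ... | inj₁ (f , f∈ , eq , refl , refl) with fun-from (at i) f∈ eq
  ...   | _ , x , nth≡ , refl , refl = executed x nth≡
    where
    executed : ∀ x → nth P i ≡ just x → Invariant (to (atFun i x) , body (atFun i x) ++ Ψ)
    executed (inc r l) nth≡ =
      inj₁ (running (reach-step reach (↝-inc nth≡)) (↭-trans (prep _ Ψ↭) (↭-sym (base-inc-↭ ρ (below nth≡)))))
    executed (dec r l₁ l₂) nth≡ = inj₁ (probing reach nth≡ (prep _ (prep _ Ψ↭)))
    executed halt nth≡ = inj₂ (inj₂ (_ , reach , nth≡))

  probing-⟶ : ∀ {i ρ r l₁ l₂ Ψ Q' Ψ'} → Reach (mconf i ρ) → nth P i ≡ just (dec r l₁ l₂) →
              Ψ ↭ ret full i r ∷ ret empty i r ∷ base ρ → C₀ ⊢ (⌜ probe r ⌝ , Ψ) ⟶ (Q' , Ψ') → Invariant (Q' , Ψ')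
  probing-⟶ {i} {ρ} {r} {Ψ = Ψ} reach nth≡ Ψ↭ move with ρ r in ρr≡
  ... | suc v with pending-⟶ Ψ↭unit (not-ret {full} ∷ not-ret {empty} ∷ base-unit (update ρ r v) {r}) move
    where
    not-ret : ∀ {b} → src (ret b i r) ≡ ⌜ probe r ⌝ → ret b i r ≡ unit r
    not-ret {b} eq = case ⌜⌝-injective {gate b r} {probe r} eq of λ ()
    Ψ↭unit : Ψ ↭ unit r ∷ ret full i r ∷ ret empty i r ∷ base (update ρ r v)
    Ψ↭unit = ↭-trans Ψ↭ (↭-trans (prep _ (prep _ (base-dec-↭ ρ (below nth≡) ρr≡)))
                                 (shift _ (ret full i r ∷ ret empty i r ∷ []) _))
  ...   | inj₁ (refl , Ψ'↭) = inj₁ (stage₁ (handshake nth≡ refl (reach-step reach (↝-dec-suc nth≡ ρr≡))) Ψ'↭)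
  ...   | inj₂ (refl , refl) = elapsed (probe r) Ψ↭ (refl ∷ refl ∷ base-instant ρ)
  probing-⟶ {i} {ρ} {r} reach nth≡ Ψ↭ move
      | zero with quiet-⟶ (All-resp-↭ (↭-sym Ψ↭) (not-ret {full} ∷ not-ret {empty} ∷ base-quiet-probe ρ ρr≡)) move
    where
    not-ret : ∀ {b} → src (ret b i r) ≢ ⌜ probe r ⌝
    not-ret {b} eq = case ⌜⌝-injective {gate b r} {probe r} eq of λ ()
  ...   | inj₂ (refl , refl) = elapsed (probe r) Ψ↭ (refl ∷ refl ∷ base-instant ρ)
  ...   | inj₁ (f , f∈ , eq , refl , refl) with fun-from (probe r) f∈ eq
  ...     | _ , _ , _ , refl =
    inj₁ (stage₁ (handshake nth≡ refl (reach-step reach (↝-dec-zero nth≡ ρr≡))) (↭-trans Ψ↭ (swap _ _ ↭-refl)))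

  stage₁-⟶ : ∀ {b i r c' Ψ Q' Ψ'} → Handshake b i r c' → Ψ ↭ ret b i r ∷ ret (flip b) i r ∷ base (regs c') →
             C₀ ⊢ (⌜ gate b r ⌝ , Ψ) ⟶ (Q' , Ψ') → Invariant (Q' , Ψ')
  stage₁-⟶ {b} {i} {r} {c'} hs Ψ↭ move
    with pending-⟶ Ψ↭ ((λ eq → ⊥-elim (gate-flip b r eq)) ∷
                       onlyFrom (ret b i r) (base-quiet (regs c') {gate b r} (λ ()) (λ ()))) move
  ... | inj₁ (refl , Ψ'↭) = inj₁ (stage₂ hs Ψ'↭)
  ... | inj₂ (refl , refl) = elapsed (gate b r) Ψ↭ (refl ∷ refl ∷ base-instant _)

  stage₂-⟶ : ∀ {b i r c' Ψ Q' Ψ'} → Handshake b i r c' → Ψ ↭ ret (flip b) i r ∷ base (regs c') →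
             C₀ ⊢ (⌜ handler b i ⌝ , Ψ) ⟶ (Q' , Ψ') → Invariant (Q' , Ψ')
  stage₂-⟶ {b} {i} {r} {c'} {Ψ} hs@(handshake {l₁} {l₂} instr target _) Ψ↭ move
    with quiet-⟶ (All-resp-↭ (↭-sym Ψ↭) (ret≢ ∷ base-quiet (regs c') {handler b i} (λ ()) (λ ()))) move
    where
    ret≢ : src (ret (flip b) i r) ≢ ⌜ handler b i ⌝
    ret≢ eq = case ⌜⌝-injective {gate (flip b) r} {handler b i} eq of λ ()
  ... | inj₂ (refl , refl) = elapsed (handler b i) Ψ↭ (refl ∷ base-instant _)
  ... | inj₁ (f , f∈ , eq , refl , refl) with fun-from (handler b i) f∈ eq
  ...   | _ , _ , nth≡ , refl , _ , _ , _ , refl , refl with refl ← trans (sym instr) nth≡ =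
    inj₁ (stage₃ hs (subst (λ l → mark (flip b) i (exit b l₁ l₂) ∷ Ψ ↭ mark (flip b) i l ∷ ret (flip b) i r ∷ base (regs c'))
                           (sym target) (prep _ Ψ↭)))

  stage₃-⟶ : ∀ {b i r c' Ψ Q' Ψ'} → Handshake b i r c' →
             Ψ ↭ mark (flip b) i (pc c') ∷ ret (flip b) i r ∷ base (regs c') →
             C₀ ⊢ (⌜ gate (flip b) r ⌝ , Ψ) ⟶ (Q' , Ψ') → Invariant (Q' , Ψ')
  stage₃-⟶ {b} {i} {r} {c'} hs Ψ↭ move
    with pending-⟶ (↭-trans Ψ↭ (swap _ _ ↭-refl))
                   (mark≢ ∷ onlyFrom (ret (flip b) i r) (base-quiet (regs c') {gate (flip b) r} (λ ()) (λ ()))) move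
    where
    mark≢ : src (mark (flip b) i (pc c')) ≡ ⌜ gate (flip b) r ⌝ → mark (flip b) i (pc c') ≡ ret (flip b) i r
    mark≢ eq = case ⌜⌝-injective {handler (flip b) i} {gate (flip b) r} eq of λ ()
  ... | inj₁ (refl , Ψ'↭) = inj₁ (stage₄ hs Ψ'↭)
  ... | inj₂ (refl , refl) = elapsed (gate (flip b) r) Ψ↭ (refl ∷ refl ∷ base-instant _)

  stage₄-⟶ : ∀ {b i r c' Ψ Q' Ψ'} → Handshake b i r c' → Ψ ↭ mark (flip b) i (pc c') ∷ base (regs c') →
             C₀ ⊢ (⌜ handler (flip b) i ⌝ , Ψ) ⟶ (Q' , Ψ') → Invariant (Q' , Ψ')
  stage₄-⟶ {b} {i} {r} {c'} hs Ψ↭ move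
    with pending-⟶ Ψ↭ (onlyFrom (mark (flip b) i (pc c')) (base-quiet (regs c') {handler (flip b) i} (λ ()) (λ ()))) move
  ... | inj₁ (refl , Ψ'↭) = inj₁ (running (Handshake.reach hs) Ψ'↭)
  ... | inj₂ (refl , refl) = elapsed (handler (flip b) i) Ψ↭ (refl ∷ base-instant _)

  canonical-⟶ : ∀ {s Q' Ψ'} → Canonical s → C₀ ⊢ s ⟶ (Q' , Ψ') → Invariant (Q' , Ψ')
  canonical-⟶ loading = loading-⟶
  canonical-⟶ (running reach Ψ↭) = running-⟶ reach Ψ↭
  canonical-⟶ (probing reach nth≡ Ψ↭) = probing-⟶ reach nth≡ Ψ↭
  canonical-⟶ (stage₁ hs Ψ↭) = stage₁-⟶ hs Ψ↭
  canonical-⟶ (stage₂ hs Ψ↭) = stage₂-⟶ hs Ψ↭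
  canonical-⟶ (stage₃ hs Ψ↭) = stage₃-⟶ hs Ψ↭
  canonical-⟶ (stage₄ hs Ψ↭) = stage₄-⟶ hs Ψ↭

  dead-⟶ : ∀ {Q Ψ Q' Ψ'} → Dead (Q , Ψ) → C₀ ⊢ (Q , Ψ) ⟶ (Q' , Ψ') → Dead (Q' , Ψ')
  dead-⟶ ((Q≢initial , _) , _) (fire _ (here refl) eq _) = ⊥-elim (Q≢initial (sym eq))
  dead-⟶ (_ , safeΨ) (fire _ (there f∈) _ _) with safeTo , safeBody ← All.lookup (machineFuns-safe 0 P) f∈ =
    safeTo , All.++⁺ safeBody safeΨ
  dead-⟶ (_ , safeΨ) (trigger Ψ₁ Ψ₂) with safe₁ , safeE ∷ safe₂ ← All.++⁻ Ψ₁ safeΨ = safeE , All.++⁺ safe₁ safe₂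
  dead-⟶ (safeQ , safeΨ) (elapse _) = safeQ , tick-All _ safeΨ

  invariant-⟶* : ∀ {s s'} → Invariant s → C₀ ⊢ s ⟶* s' → Invariant s'
  invariant-⟶* inv ε = inv
  invariant-⟶* (inj₁ canonical) (move ◅ moves) = invariant-⟶* (canonical-⟶ canonical move) moves
  invariant-⟶* (inj₂ (inj₁ dead)) (move ◅ moves) = invariant-⟶* (inj₂ (inj₁ (dead-⟶ dead move))) moves
  invariant-⟶* (inj₂ (inj₂ halts)) (_ ◅ moves) = invariant-⟶* (inj₂ (inj₂ halts)) moves

  canonical-safe : ∀ {Q Ψ} → Canonical (Q , Ψ) → Q ≢ ⌜ final ⌝
  canonical-safe loading eq = case ⌜⌝-injective {initial} {final} eq of λ ()
  canonical-safe (running {i} _ _) = proj₂ (safe (at i))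
  canonical-safe (probing {r = r} _ _ _) = proj₂ (safe (probe r))
  canonical-safe (stage₁ {b} {r = r} _ _) = proj₂ (safe (gate b r))
  canonical-safe (stage₂ {b} {i} _ _) = proj₂ (safe (handler b i))
  canonical-safe (stage₃ {b} {r = r} _ _) = proj₂ (safe (gate (flip b) r))
  canonical-safe (stage₄ {b} {i} _ _) = proj₂ (safe (handler (flip b) i))

  soundness : Reachable′ C₀ ⌜ final ⌝ → ReachesHalt P E
  soundness (_ , moves) with invariant-⟶* (inj₁ loading) moves
  ... | inj₁ canonical = ⊥-elim (canonical-safe canonical refl)
  ... | inj₂ (inj₁ ((_ , ≢final) , _)) = ⊥-elim (≢final refl)
  ... | inj₂ (inj₂ halts) = halts

  fire-↭ : ∀ {f X Ψ T} → f ∈ funs C₀ → from f ≡ X → Ψ ↭ T → All (λ e → src e ≢ X) T →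
           C₀ ⊢ (X , Ψ) ⟶ (to f , body f ++ Ψ)
  fire-↭ f∈ eq Ψ↭ quiet = fire _ f∈ eq (quiet⇒nored (All-resp-↭ (↭-sym Ψ↭) quiet))

  instrFun : ∀ {i x f} → nth P i ≡ just x → f ∈ instrFuns i x → f ∈ funs C₀
  instrFun nth≡ f∈ = there (machineFuns-∈ 0 P nth≡ f∈)

  handlerFun-∈ : ∀ b {i r l₁ l₂} → handlerFun b i r l₁ l₂ ∈ instrFuns i (dec r l₁ l₂)
  handlerFun-∈ full = there (there (here refl))
  handlerFun-∈ empty = there (there (there (here refl)))

  handshake-run : ∀ {b i r l₁ l₂ σ Ψ} → nth P i ≡ just (dec r l₁ l₂) → Ψ ↭ ret b i r ∷ ret (flip b) i r ∷ base σ →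
                  ∃[ Ψ' ] C₀ ⊢ (⌜ gate b r ⌝ , Ψ) ⟶* (⌜ at (exit b l₁ l₂) ⌝ , Ψ') × Ψ' ↭ base σ
  handshake-run {b} {i} {r} {l₁} {l₂} {σ} nth≡ Ψ↭
    with Ψ₁ , move₁ , Ψ₁↭ ← trigger-↭ Ψ↭
    with Ψ₃ , move₃ , Ψ₃↭ ← trigger-↭ {Φ = mark (flip b) i (exit b l₁ l₂) ∷ base σ} (↭-trans (prep _ Ψ₁↭) (swap _ _ ↭-refl))
    with Ψ₄ , move₄ , Ψ₄↭ ← trigger-↭ Ψ₃↭ =
    Ψ₄ , move₁ ◅ move₂ ◅ move₃ ◅ move₄ ◅ ε , Ψ₄↭
    where
    move₂ : C₀ ⊢ (⌜ handler b i ⌝ , Ψ₁) ⟶ (⌜ gate (flip b) r ⌝ , mark (flip b) i (exit b l₁ l₂) ∷ Ψ₁)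
    move₂ = fire-↭ (instrFun nth≡ (handlerFun-∈ b)) refl Ψ₁↭
                   ((λ eq → case ⌜⌝-injective {gate (flip b) r} {handler b i} eq of λ ()) ∷
                    base-quiet σ {handler b i} (λ ()) (λ ()))

  machine-step-run : ∀ {c c' Ψ} → P ⊢ c ↝ c' → Ψ ↭ base (regs c) →
                     ∃[ Ψ' ] C₀ ⊢ (⌜ at (pc c) ⌝ , Ψ) ⟶* (⌜ at (pc c') ⌝ , Ψ') × Ψ' ↭ base (regs c')
  machine-step-run {mconf i ρ} {Ψ = Ψ} s Ψ↭ with nth P i in nth≡
  ... | nothing = ⊥-elim (outside-stuck nth≡ s)
  ... | just halt = ⊥-elim (halt-stuck nth≡ s)
  ... | just (inc r l) with refl ← ↝-deterministic s (↝-inc nth≡) =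
    unit r ∷ Ψ , fire-↭ (instrFun nth≡ (here refl)) refl Ψ↭ (base-quiet ρ {at i} (λ ()) (λ ())) ◅ ε ,
    ↭-trans (prep _ Ψ↭) (↭-sym (base-inc-↭ ρ (below nth≡)))
  ... | just (dec r l₁ l₂) with ρ r in ρr≡
  ...   | suc v with refl ← ↝-deterministic s (↝-dec-suc nth≡ ρr≡) =
    let Ψ₂ , move₂ , Ψ₂↭ = trigger-↭ {Φ = ret full i r ∷ ret empty i r ∷ base (update ρ r v)}
                             (↭-trans (prep _ (prep _ (↭-trans Ψ↭ (base-dec-↭ ρ (below nth≡) ρr≡))))
                                      (shift _ (ret full i r ∷ ret empty i r ∷ []) _))
        Ψ' , moves , Ψ'↭ = handshake-run {full} {σ = update ρ r v} nth≡ Ψ₂↭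
    in Ψ' , move₁ ◅ move₂ ◅ moves , Ψ'↭
    where
    move₁ : C₀ ⊢ (⌜ at i ⌝ , Ψ) ⟶ (⌜ probe r ⌝ , ret full i r ∷ ret empty i r ∷ Ψ)
    move₁ = fire-↭ (instrFun nth≡ (here refl)) refl Ψ↭ (base-quiet ρ {at i} (λ ()) (λ ()))
  ...   | zero with refl ← ↝-deterministic s (↝-dec-zero nth≡ ρr≡) =
    let Ψ' , moves , Ψ'↭ = handshake-run {empty} {σ = ρ} nth≡ (swap _ _ Ψ↭)
    in Ψ' , move₁ ◅ move₂ ◅ moves , Ψ'↭
    where
    move₁ : C₀ ⊢ (⌜ at i ⌝ , Ψ) ⟶ (⌜ probe r ⌝ , ret full i r ∷ ret empty i r ∷ Ψ)
    move₁ = fire-↭ (instrFun nth≡ (here refl)) refl Ψ↭ (base-quiet ρ {at i} (λ ()) (λ ()))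
    not-ret : ∀ b → src (ret b i r) ≢ ⌜ probe r ⌝
    not-ret b eq = case ⌜⌝-injective {gate b r} {probe r} eq of λ ()
    move₂ : C₀ ⊢ (⌜ probe r ⌝ , ret full i r ∷ ret empty i r ∷ Ψ) ⟶ (⌜ gate empty r ⌝ , ret full i r ∷ ret empty i r ∷ Ψ)
    move₂ = fire-↭ (instrFun nth≡ (there (here refl))) refl (prep _ (prep _ Ψ↭))
                   (not-ret full ∷ not-ret empty ∷ base-quiet-probe ρ ρr≡)

  machine-run : ∀ {c c' Ψ} → P ⊢ c ↝* c' → Ψ ↭ base (regs c) →
                ∃[ Ψ' ] C₀ ⊢ (⌜ at (pc c) ⌝ , Ψ) ⟶* (⌜ at (pc c') ⌝ , Ψ') × Ψ' ↭ base (regs c')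
  machine-run ε Ψ↭ = _ , ε , Ψ↭
  machine-run (s ◅ steps) Ψ↭ with Ψ₁ , moves₁ , Ψ₁↭ ← machine-step-run s Ψ↭
                             with Ψ₂ , moves₂ , Ψ₂↭ ← machine-run steps Ψ₁↭ = Ψ₂ , moves₁ ◅◅ moves₂ , Ψ₂↭

  completeness : ReachesHalt P E → Reachable′ C₀ ⌜ final ⌝
  completeness (mconf i ρ , reach , nth≡) with Ψ , moves , Ψ↭ ← machine-run reach loaded
                                          with Ψ' , sentinel-move , _ ← trigger-↭ Ψ↭ =
    Ψ' , fire _ (here refl) refl [] ◅ moves ◅◅ halt-move ◅ sentinel-move ◅ ε
    where
    halt-move : C₀ ⊢ (⌜ at i ⌝ , Ψ) ⟶ (⌜ halted ⌝ , Ψ)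
    halt-move = fire-↭ (instrFun nth≡ (here refl)) refl Ψ↭ (base-quiet ρ {at i} (λ ()) (λ ()))

machineContract-reachable⇔halts : ∀ P E →
  Reachable (machineContract P E) ⌜ final ⌝ ⇔ ReachesHalt P E
machineContract-reachable⇔halts P E = mk⇔
  (λ reachable → soundness (reachable′-transfer same (to reachable⇔reachable′ reachable)))
  (λ halts → from reachable⇔reachable′ (reachable′-transfer (sameUpToLines-sym same) (completeness halts)))
  where
  open Simulation P E
  open Equivalence
  same : SameUpToLines (machineContract P E) (machineContract₀ P E)
  same = machineContract-sameUpToLines P E

-- Structured register programs

Regs : Set
Regs = ℕ → ℕ

-- Unconditional jumps are dec jumpReg l l. Structured programs never increment jumpReg, so it
-- stays 0 while they run and their jumps leave the registers unchanged.
jumpReg : ℕ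
jumpReg = 1

jump : ℕ → Instr
jump l = dec jumpReg l l

infixr 5 _⨾_

data Stmt : Set where
  INC  : ℕ → Stmt
  SKIP : Stmt
  _⨾_  : Stmt → Stmt → Stmt
  LOOP : ℕ → Stmt → Stmt

len : Stmt → ℕ
len (INC r) = 1
len SKIP = 0
len (s ⨾ t) = len s + len t
len (LOOP r s) = suc (len s + 1)

code : ℕ → Stmt → List Instr
code o (INC r) = [ inc r (suc o) ]
code o SKIP = []
code o (s ⨾ t) = code o s ++ code (o + len s) t
code o (LOOP r s) = dec r (suc o) (o + len (LOOP r s)) ∷ code (suc o) s ++ [ jump o ]

length-code : ∀ o s → length (code o s) ≡ len s
length-code o (INC r) = refl
length-code o SKIP = refl
length-code o (s ⨾ t) = trans (length-++ (code o s)) (cong₂ _+_ (length-code o s) (length-code (o + len s) t))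
length-code o (LOOP r s) = cong suc (trans (length-++ (code (suc o) s)) (cong (_+ 1) (length-code (suc o) s)))

infix 4 _⊢_⇓_

data _⊢_⇓_ : Stmt → Regs → Regs → Set where
  inc       : ∀ {r ρ} → r ≢ jumpReg → INC r ⊢ ρ ⇓ update ρ r (suc (ρ r))
  skip      : ∀ {ρ} → SKIP ⊢ ρ ⇓ ρ
  seq       : ∀ {s t ρ ρ₁ ρ₂} → s ⊢ ρ ⇓ ρ₁ → t ⊢ ρ₁ ⇓ ρ₂ → s ⨾ t ⊢ ρ ⇓ ρ₂
  loop-exit : ∀ {r s ρ} → ρ r ≡ 0 → LOOP r s ⊢ ρ ⇓ ρ
  loop-iter : ∀ {r s ρ ρ₁ ρ₂ v} → ρ r ≡ suc v → s ⊢ update ρ r v ⇓ ρ₁ → LOOP r s ⊢ ρ₁ ⇓ ρ₂ → LOOP r s ⊢ ρ ⇓ ρ₂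

⇓-jumpReg : ∀ {s ρ ρ'} → s ⊢ ρ ⇓ ρ' → ρ jumpReg ≡ 0 → ρ' jumpReg ≡ 0
⇓-jumpReg {ρ = ρ} (inc r≢J) J≡0 = trans (update-other ρ _ _ (λ J≡r → r≢J (sym J≡r))) J≡0
⇓-jumpReg skip J≡0 = J≡0
⇓-jumpReg (seq s⇓ t⇓) J≡0 = ⇓-jumpReg t⇓ (⇓-jumpReg s⇓ J≡0)
⇓-jumpReg (loop-exit _) J≡0 = J≡0
⇓-jumpReg {ρ = ρ} (loop-iter {r = r} {v = v} ρr≡ s⇓ loop⇓) J≡0 =
  ⇓-jumpReg loop⇓ (⇓-jumpReg s⇓ (trans (update-other ρ r v J≢r) J≡0))
  where
  J≢r : jumpReg ≢ r
  J≢r refl with () ← trans (sym J≡0) ρr≡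

record Embedded (xs : List Instr) (P : Program) (o : ℕ) : Set where
  constructor embed
  field placed : ∀ {k x} → nth xs k ≡ just x → nth P (o + k) ≡ just x
open Embedded

nth-++ˡ : ∀ {A : Set} (xs ys : List A) {k x} → nth xs k ≡ just x → nth (xs ++ ys) k ≡ just x
nth-++ˡ (x ∷ xs) ys {zero} eq = eq
nth-++ˡ (x ∷ xs) ys {suc k} eq = nth-++ˡ xs ys eq

nth-++ʳ : ∀ {A : Set} (xs ys : List A) k → nth (xs ++ ys) (length xs + k) ≡ nth ys k
nth-++ʳ [] ys k = refl
nth-++ʳ (x ∷ xs) ys k = nth-++ʳ xs ys k

embedded-++ˡ : ∀ {xs ys P o} → Embedded (xs ++ ys) P o → Embedded xs P o
embedded-++ˡ {xs} {ys} emb = embed λ eq → placed emb (nth-++ˡ xs ys eq)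

embedded-++ʳ : ∀ {xs ys P o} → Embedded (xs ++ ys) P o → Embedded ys P (o + length xs)
embedded-++ʳ {xs} {ys} {P} {o} emb = embed λ {k} {x} eq →
  subst (λ i → nth P i ≡ just x) (sym (+-assoc o (length xs) k)) (placed emb (trans (nth-++ʳ xs ys k) eq))

embedded-head : ∀ {x xs P o} → Embedded (x ∷ xs) P o → nth P o ≡ just x
embedded-head {x} {P = P} {o} emb = subst (λ i → nth P i ≡ just x) (+-identityʳ o) (placed emb {0} refl)

embedded-tail : ∀ {x xs P o} → Embedded (x ∷ xs) P o → Embedded xs P (suc o)
embedded-tail {P = P} {o} emb = embed λ {k} {x} eq → subst (λ i → nth P i ≡ just x) (+-suc o k) (placed emb {suc k} eq)

↝*-pc : ∀ {P c i j ρ} → i ≡ j → P ⊢ c ↝* mconf i ρ → P ⊢ c ↝* mconf j ρ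
↝*-pc refl steps = steps

⇓⇒↝* : ∀ {P s ρ ρ'} o → s ⊢ ρ ⇓ ρ' → ρ jumpReg ≡ 0 → Embedded (code o s) P o →
       P ⊢ mconf o ρ ↝* mconf (o + len s) ρ'
⇓⇒↝* o (inc _) _ emb = ↝*-pc (+-comm 1 o) (↝-inc (embedded-head emb) ◅ ε)
⇓⇒↝* o skip _ _ = ↝*-pc (sym (+-identityʳ o)) ε
⇓⇒↝* {P} {s ⨾ t} o (seq s⇓ t⇓) J≡0 emb =
  ⇓⇒↝* o s⇓ J≡0 (embedded-++ˡ emb) ◅◅
  ↝*-pc (+-assoc o (len s) (len t))
        (⇓⇒↝* (o + len s) t⇓ (⇓-jumpReg s⇓ J≡0)
              (subst (Embedded (code (o + len s) t) P) (cong (o +_) (length-code o s)) (embedded-++ʳ {code o s} emb)))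
⇓⇒↝* o (loop-exit ρr≡0) _ emb = ↝-dec-zero (embedded-head emb) ρr≡0 ◅ ε
⇓⇒↝* {P} {LOOP r s} {ρ} o (loop-iter {v = v} ρr≡ s⇓ loop⇓) J≡0 emb =
  ↝-dec-suc (embedded-head emb) ρr≡ ◅
  ⇓⇒↝* (suc o) s⇓ J≡0′ (embedded-++ˡ (embedded-tail emb)) ◅◅
  ↝-dec-zero back (⇓-jumpReg s⇓ J≡0′) ◅
  ⇓⇒↝* o loop⇓ (⇓-jumpReg s⇓ J≡0′) emb
  where
  J≢r : jumpReg ≢ r
  J≢r refl with () ← trans (sym J≡0) ρr≡
  J≡0′ : update ρ r v jumpReg ≡ 0
  J≡0′ = trans (update-other ρ r v J≢r) J≡0
  back : nth P (suc o + len s) ≡ just (jump o)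
  back = subst (λ i → nth P (suc o + i) ≡ just (jump o)) (length-code (suc o) s)
               (embedded-head (embedded-++ʳ {code (suc o) s} (embedded-tail emb)))

↝-jump : ∀ {P c l} → nth P (pc c) ≡ just (jump l) →
         ∃[ c' ] P ⊢ c ↝ c' × pc c' ≡ l × (∀ {i} → i ≢ jumpReg → regs c' i ≡ regs c i)
↝-jump {c = c} eq with regs c jumpReg in J≡
... | zero = _ , ↝-dec-zero eq J≡ , refl , λ _ → refl
... | suc v = _ , ↝-dec-suc eq J≡ , refl , λ i≢J → update-other (regs c) jumpReg v i≢J

trapped : ∀ {P c c' l} → nth P l ≡ just (jump l) → pc c ≡ l → P ⊢ c ↝* c' → pc c' ≡ l
trapped loop refl ε = refl
trapped loop refl (s ◅ steps) with _ , s' , pc≡ , _ ← ↝-jump loop with refl ← ↝-deterministic s s' = trapped loop pc≡ steps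

jump≢halt : ∀ {l} → just (jump l) ≢ just halt
jump≢halt ()

trapped-never-halts : ∀ {P s c₁ c₂ l} → nth P l ≡ just (jump l) → pc c₁ ≡ l → P ⊢ s ↝* c₁ → P ⊢ s ↝* c₂ →
                      nth P (pc c₂) ≡ just halt → ⊥
trapped-never-halts {P} loop pc₁≡l run₁ run₂ at-halt with ↝*-connex run₁ run₂
... | inj₁ run = jump≢halt (trans (sym loop) (trans (cong (nth P) (sym (trapped loop pc₁≡l run))) at-halt))
... | inj₂ ε = jump≢halt (trans (sym loop) (trans (cong (nth P) (sym pc₁≡l)) at-halt))
... | inj₂ (s ◅ _) = halt-stuck at-halt s

-- Register macros and an expression compiler

infixl 6 _[_≔_]

_[_≔_] : Regs → ℕ → ℕ → Regs
α [ r ≔ v ] = update α r v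

≗-update : ∀ {α β r v} → β r ≡ v → (∀ {i} → i ≢ r → β i ≡ α i) → β ≗ α [ r ≔ v ]
≗-update {α} {β} {r} {v} βr≡v βi≡αi i with i ≟ r
... | yes refl = trans βr≡v (sym (update-same α r v))
... | no i≢r = trans (βi≡αi i≢r) (sym (update-other α r v i≢r))

update-cong : ∀ {σ α} r v → σ ≗ α → σ [ r ≔ v ] ≗ α [ r ≔ v ]
update-cong {σ} {α} r v σ≗α = ≗-update (update-same σ r v) (λ {i} i≢r → trans (update-other σ r v i≢r) (σ≗α i))

infix 4 _⊢_⇛_

record _⊢_⇛_ (s : Stmt) (α β : Regs) : Set where
  constructor runs
  field run : ∀ {σ} → σ ≗ α → ∃[ σ' ] s ⊢ σ ⇓ σ' × σ' ≗ β
open _⊢_⇛_ public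

⇛-≗ : ∀ {s α β γ} → β ≗ γ → s ⊢ α ⇛ β → s ⊢ α ⇛ γ
⇛-≗ β≗γ spec = runs λ σ≗α → let σ' , ran , σ'≗β = run spec σ≗α in σ' , ran , λ i → trans (σ'≗β i) (β≗γ i)

⇛-pre : ∀ {s α α' β} → α ≗ α' → s ⊢ α' ⇛ β → s ⊢ α ⇛ β
⇛-pre α≗α' spec = runs λ σ≗α → run spec (λ i → trans (σ≗α i) (α≗α' i))

⇛-skip : ∀ {α} → SKIP ⊢ α ⇛ α
⇛-skip = runs λ σ≗α → _ , skip , σ≗α

⇛-inc : ∀ {r α} → r ≢ jumpReg → INC r ⊢ α ⇛ α [ r ≔ suc (α r) ]
⇛-inc {r} {α} r≢J = runs λ {σ} σ≗α →
  _ , inc r≢J , λ i → trans (cong (λ v → update σ r (suc v) i) (σ≗α r)) (update-cong r _ σ≗α i)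

⇛-seq : ∀ {s t α β γ} → s ⊢ α ⇛ β → t ⊢ β ⇛ γ → s ⨾ t ⊢ α ⇛ γ
⇛-seq spec₁ spec₂ = runs λ σ≗α →
  let σ₁ , run₁ , σ₁≗β = run spec₁ σ≗α
      σ₂ , run₂ , σ₂≗γ = run spec₂ σ₁≗β
  in σ₂ , seq run₁ run₂ , σ₂≗γ

⇛-loop-exit : ∀ {r s α} → α r ≡ 0 → LOOP r s ⊢ α ⇛ α
⇛-loop-exit αr≡0 = runs λ σ≗α → _ , loop-exit (trans (σ≗α _) αr≡0) , σ≗α

⇛-loop-iter : ∀ {r s α β γ v} → α r ≡ suc v → s ⊢ α [ r ≔ v ] ⇛ β → LOOP r s ⊢ β ⇛ γ → LOOP r s ⊢ α ⇛ γ
⇛-loop-iter {r} {v = v} αr≡ body loop = runs λ σ≗α →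
  let σ₁ , run₁ , σ₁≗β = run body (update-cong r v σ≗α)
      σ₂ , run₂ , σ₂≗γ = run loop σ₁≗β
  in σ₂ , loop-iter (trans (σ≗α r) αr≡) run₁ run₂ , σ₂≗γ

≗-update₂ : ∀ {α β a d x y} → β a ≡ x → β d ≡ y → (∀ {i} → i ≢ a → i ≢ d → β i ≡ α i) → β ≗ α [ d ≔ y ] [ a ≔ x ]
≗-update₂ {α} {β} {a} {d} {x} {y} βa≡x βd≡y βi≡αi = ≗-update βa≡x rest
  where
  rest : ∀ {i} → i ≢ a → β i ≡ (α [ d ≔ y ]) i
  rest {i} i≢a with i ≟ d
  ... | yes refl = trans βd≡y (sym (update-same α d y))
  ... | no i≢d = trans (βi≡αi i≢a i≢d) (sym (update-other α d y i≢d))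

≗-update₃ : ∀ {α β a d e x y z} → β a ≡ x → β d ≡ y → β e ≡ z → (∀ {i} → i ≢ a → i ≢ d → i ≢ e → β i ≡ α i) →
            β ≗ α [ e ≔ z ] [ d ≔ y ] [ a ≔ x ]
≗-update₃ {α} {β} {a} {d} {e} {x} {y} {z} βa≡x βd≡y βe≡z βi≡αi = ≗-update₂ βa≡x βd≡y rest
  where
  rest : ∀ {i} → i ≢ a → i ≢ d → β i ≡ (α [ e ≔ z ]) i
  rest {i} i≢a i≢d with i ≟ e
  ... | yes refl = trans βe≡z (sym (update-same α e z))
  ... | no i≢e = trans (βi≡αi i≢a i≢d i≢e) (sym (update-other α e z i≢e))

accumulate : (ℕ → ℕ) → ℕ → ℕ → ℕ
accumulate δ zero m = m
accumulate δ (suc k) m = accumulate δ k (δ k + m)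

update-twice : ∀ α r x y → α [ r ≔ x ] [ r ≔ y ] ≗ α [ r ≔ y ]
update-twice α r x y =
  ≗-update (update-same (α [ r ≔ x ]) r y) (λ i≢r → trans (update-other (α [ r ≔ x ]) r y i≢r) (update-other α r x i≢r))

loop-⇛ : ∀ {a s} (H : ℕ → Regs) (δ : ℕ → ℕ) → (∀ k m → s ⊢ H m [ a ≔ k ] ⇛ H (δ k + m) [ a ≔ k ]) →
         ∀ k m → LOOP a s ⊢ H m [ a ≔ k ] ⇛ H (accumulate δ k m) [ a ≔ 0 ]
loop-⇛ {a} H δ iteration zero m = ⇛-loop-exit (update-same (H m) a 0)
loop-⇛ {a} H δ iteration (suc k) m =
  ⇛-loop-iter (update-same (H m) a (suc k)) (⇛-pre (update-twice (H m) a (suc k) k) (iteration k m))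
              (loop-⇛ H δ iteration k (δ k + m))

accumulate-1 : ∀ k m → accumulate (λ _ → 1) k m ≡ k + m
accumulate-1 zero m = refl
accumulate-1 (suc k) m = trans (accumulate-1 k (suc m)) (+-suc k m)

MOVE : ℕ → ℕ → Stmt
MOVE a d = LOOP a (INC d)

move-⇛ : ∀ {a d α} → a ≢ d → d ≢ jumpReg → MOVE a d ⊢ α ⇛ α [ d ≔ α d + α a ] [ a ≔ 0 ]
move-⇛ {a} {d} {α} a≢d d≢J =
  ⇛-pre (≗-update₂ refl refl λ _ _ → refl)
        (⇛-≗ (λ i → cong (λ v → (α [ d ≔ v ] [ a ≔ 0 ]) i) (trans (accumulate-1 (α a) (α d)) (+-comm (α a) (α d))))
             (loop-⇛ (λ m → α [ d ≔ m ]) (λ _ → 1) iteration (α a) (α d)))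
  where
  iteration : ∀ k m → INC d ⊢ α [ d ≔ m ] [ a ≔ k ] ⇛ α [ d ≔ suc m ] [ a ≔ k ]
  iteration k m = ⇛-≗ (≗-update₂ (trans (update-other γ d _ a≢d) (update-same β a k))
                                 (trans (update-same γ d _) (cong suc γd≡m))
                                 (λ i≢a i≢d → trans (update-other γ d _ i≢d) (trans (update-other β a k i≢a) (update-other α d m i≢d))))
                      (⇛-inc d≢J)
    where
    β : Regs
    β = α [ d ≔ m ]
    γ : Regs
    γ = β [ a ≔ k ]
    γd≡m : γ d ≡ m
    γd≡m = trans (update-other β a k (≢-sym a≢d)) (update-same α d m)

update-id : ∀ α r → α ≗ α [ r ≔ α r ]
update-id α r = ≗-update refl (λ _ → refl)

MOVE2 : ℕ → ℕ → ℕ → Stmt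
MOVE2 a d e = LOOP a (INC d ⨾ INC e)

move2-⇛ : ∀ {a d e α} → a ≢ d → a ≢ e → d ≢ e → d ≢ jumpReg → e ≢ jumpReg →
          MOVE2 a d e ⊢ α ⇛ α [ e ≔ α e + α a ] [ d ≔ α d + α a ] [ a ≔ 0 ]
move2-⇛ {a} {d} {e} {α} a≢d a≢e d≢e d≢J e≢J =
  ⇛-pre (≗-update₃ refl refl refl λ _ _ _ → refl)
        (⇛-≗ (λ i → trans (cong (λ j → (H j [ a ≔ 0 ]) i) (trans (accumulate-1 (α a) 0) (+-identityʳ (α a))))
                          (cong₂ (λ x y → (α [ e ≔ x ] [ d ≔ y ] [ a ≔ 0 ]) i) (+-comm (α a) (α e)) (+-comm (α a) (α d))))
             (loop-⇛ H (λ _ → 1) iteration (α a) 0))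
  where
  H : ℕ → Regs
  H j = α [ e ≔ j + α e ] [ d ≔ j + α d ]
  iteration : ∀ k j → INC d ⨾ INC e ⊢ H j [ a ≔ k ] ⇛ H (suc j) [ a ≔ k ]
  iteration k j = ⇛-≗ (≗-update₃ γ₂a γ₂d γ₂e frame) (⇛-seq (⇛-inc d≢J) (⇛-inc e≢J))
    where
    β : Regs
    β = α [ e ≔ j + α e ]
    γ : Regs
    γ = H j [ a ≔ k ]
    γ₁ : Regs
    γ₁ = γ [ d ≔ suc (γ d) ]
    γ₂ : Regs
    γ₂ = γ₁ [ e ≔ suc (γ₁ e) ]
    γ₂a : γ₂ a ≡ k
    γ₂a = trans (update-other γ₁ e _ a≢e) (trans (update-other γ d _ a≢d) (update-same (H j) a k))
    γ₂d : γ₂ d ≡ suc j + α d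
    γ₂d = trans (update-other γ₁ e _ d≢e) (trans (update-same γ d _)
                (cong suc (trans (update-other (H j) a k (≢-sym a≢d)) (update-same β d _))))
    γ₂e : γ₂ e ≡ suc j + α e
    γ₂e = trans (update-same γ₁ e _) (cong suc (trans (update-other γ d _ (≢-sym d≢e))
                (trans (update-other (H j) a k (≢-sym a≢e)) (trans (update-other β d _ (≢-sym d≢e)) (update-same α e _)))))
    frame : ∀ {i} → i ≢ a → i ≢ d → i ≢ e → γ₂ i ≡ α i
    frame i≢a i≢d i≢e = trans (update-other γ₁ e _ i≢e) (trans (update-other γ d _ i≢d)
                          (trans (update-other (H j) a k i≢a) (trans (update-other β d _ i≢d) (update-other α e _ i≢e))))

CLEAR : ℕ → Stmt
CLEAR a = LOOP a SKIP

clear-⇛ : ∀ {a α} → CLEAR a ⊢ α ⇛ α [ a ≔ 0 ]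
clear-⇛ {a} {α} = ⇛-pre (update-id α a) (loop-⇛ (λ _ → α) (λ _ → 0) (λ _ _ → ⇛-skip) (α a) 0)

≗-by : ∀ {β γ : Regs} rs → All (λ r → β r ≡ γ r) rs → (∀ {i} → All (i ≢_) rs → β i ≡ γ i) → β ≗ γ
≗-by {β} {γ} rs listed others i with decide rs
  where
  decide : ∀ rs → Any (i ≡_) rs ⊎ All (i ≢_) rs
  decide [] = inj₂ []
  decide (r ∷ rs) with i ≟ r | decide rs
  ... | yes i≡r | _ = inj₁ (here i≡r)
  ... | no _ | inj₁ i∈rs = inj₁ (there i∈rs)
  ... | no i≢r | inj₂ i∉rs = inj₂ (i≢r ∷ i∉rs)
... | inj₂ i∉rs = others i∉rs
... | inj₁ i∈rs = pick i∈rs listed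
  where
  pick : ∀ {rs} → Any (i ≡_) rs → All (λ r → β r ≡ γ r) rs → β i ≡ γ i
  pick (here refl) (eq ∷ _) = eq
  pick (there i∈rs) (_ ∷ eqs) = pick i∈rs eqs

LIT : ℕ → ℕ → Stmt
LIT r zero = SKIP
LIT r (suc k) = INC r ⨾ LIT r k

lit-⇛ : ∀ {r α} k → r ≢ jumpReg → LIT r k ⊢ α ⇛ α [ r ≔ α r + k ]
lit-⇛ {r} {α} zero r≢J = ⇛-≗ (λ i → trans (update-id α r i) (cong (λ v → (α [ r ≔ v ]) i) (sym (+-identityʳ (α r))))) ⇛-skip
lit-⇛ {r} {α} (suc k) r≢J =
  ⇛-seq (⇛-inc r≢J) (⇛-≗ (≗-update (trans (update-same β r _) (trans (cong (_+ k) (update-same α r _)) (sym (+-suc (α r) k))))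
                                    (λ i≢r → trans (update-other β r _ i≢r) (update-other α r _ i≢r)))
                         (lit-⇛ k r≢J))
  where
  β : Regs
  β = α [ r ≔ suc (α r) ]

COPY : ℕ → ℕ → ℕ → Stmt
COPY a d t = MOVE2 a d t ⨾ MOVE t a

copy-⇛ : ∀ {a d t α} → a ≢ d → a ≢ t → d ≢ t → a ≢ jumpReg → d ≢ jumpReg → t ≢ jumpReg → α t ≡ 0 →
         COPY a d t ⊢ α ⇛ α [ d ≔ α d + α a ]
copy-⇛ {a} {d} {t} {α} a≢d a≢t d≢t a≢J d≢J t≢J αt≡0 =
  ⇛-seq (move2-⇛ a≢d a≢t d≢t d≢J t≢J) (⇛-≗ restored (move-⇛ (≢-sym a≢t) a≢J))
  where
  β₁ : Regs
  β₁ = α [ t ≔ α t + α a ]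
  β₂ : Regs
  β₂ = β₁ [ d ≔ α d + α a ]
  β : Regs
  β = β₂ [ a ≔ 0 ]
  β′ : Regs
  β′ = β [ a ≔ β a + β t ]
  βt : β t ≡ α a
  βt = trans (update-other β₂ a 0 (≢-sym a≢t)) (trans (update-other β₁ d _ (≢-sym d≢t))
             (trans (update-same α t _) (cong (_+ α a) αt≡0)))
  restored : β′ [ t ≔ 0 ] ≗ α [ d ≔ α d + α a ]
  restored = ≗-by (a ∷ d ∷ t ∷ [])
    ( trans (update-other β′ t 0 a≢t) (trans (update-same β a _) (trans (cong₂ _+_ (update-same β₂ a 0) βt)
            (sym (update-other α d _ a≢d))))
    ∷ trans (update-other β′ t 0 d≢t) (trans (update-other β a _ (≢-sym a≢d)) (trans (update-other β₂ a 0 (≢-sym a≢d))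
            (trans (update-same β₁ d _) (sym (update-same α d _)))))
    ∷ trans (update-same β′ t 0) (trans (sym αt≡0) (sym (update-other α d _ (≢-sym d≢t))))
    ∷ [])
    λ { (i≢a ∷ i≢d ∷ i≢t ∷ []) → trans (update-other β′ t 0 i≢t) (trans (update-other β a _ i≢a) (trans (update-other β₂ a 0 i≢a)
                                   (trans (update-other β₁ d _ i≢d) (trans (update-other α t _ i≢t) (sym (update-other α d _ i≢d)))))) }

TRI : ℕ → ℕ → ℕ → Stmt
TRI s d t = LOOP s (COPY s d t ⨾ INC d)

accumulate-suc : ∀ n m → accumulate suc n m ≡ tri n + m
accumulate-suc zero m = refl
accumulate-suc (suc n) m = trans (accumulate-suc n (suc n + m))
                                 (trans (sym (+-assoc (tri n) (suc n) m)) (cong (_+ m) (+-comm (tri n) (suc n))))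

tri-⇛ : ∀ {s d t α} → s ≢ d → s ≢ t → d ≢ t → s ≢ jumpReg → d ≢ jumpReg → t ≢ jumpReg → α t ≡ 0 →
        TRI s d t ⊢ α ⇛ α [ d ≔ α d + tri (α s) ] [ s ≔ 0 ]
tri-⇛ {s} {d} {t} {α} s≢d s≢t d≢t s≢J d≢J t≢J αt≡0 =
  ⇛-pre (≗-update₂ refl refl λ _ _ → refl)
        (⇛-≗ (λ i → cong (λ v → (α [ d ≔ v ] [ s ≔ 0 ]) i) (trans (accumulate-suc (α s) (α d)) (+-comm (tri (α s)) (α d))))
             (loop-⇛ (λ m → α [ d ≔ m ]) suc iteration (α s) (α d)))
  where
  iteration : ∀ k m → COPY s d t ⨾ INC d ⊢ α [ d ≔ m ] [ s ≔ k ] ⇛ α [ d ≔ suc k + m ] [ s ≔ k ]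
  iteration k m = ⇛-seq (copy-⇛ s≢d s≢t d≢t s≢J d≢J t≢J γt≡0) (⇛-≗ counted (⇛-inc d≢J))
    where
    β : Regs
    β = α [ d ≔ m ]
    γ : Regs
    γ = β [ s ≔ k ]
    γ₁ : Regs
    γ₁ = γ [ d ≔ γ d + γ s ]
    γt≡0 : γ t ≡ 0
    γt≡0 = trans (update-other β s k (≢-sym s≢t)) (trans (update-other α d m (≢-sym d≢t)) αt≡0)
    counted : γ₁ [ d ≔ suc (γ₁ d) ] ≗ α [ d ≔ suc k + m ] [ s ≔ k ]
    counted = ≗-update₂ (trans (update-other γ₁ d _ s≢d) (trans (update-other γ d _ s≢d) (update-same β s k)))
                        (trans (update-same γ₁ d _) (cong suc (trans (update-same γ d _)
                               (trans (cong₂ _+_ (trans (update-other β s k (≢-sym s≢d)) (update-same α d m)) (update-same β s k))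
                                      (+-comm m k)))))
                        (λ i≢s i≢d → trans (update-other γ₁ d _ i≢d) (trans (update-other γ d _ i≢d)
                                       (trans (update-other β s k i≢s) (update-other α d m i≢d))))

PAIR : ℕ → ℕ → ℕ → ℕ → ℕ → Stmt
PAIR a b d t u = MOVE2 b d t ⨾ MOVE a t ⨾ TRI t d u

pair-⇛ : ∀ {a b d t u α} → Unique (a ∷ b ∷ d ∷ t ∷ u ∷ []) → All (_≢ jumpReg) (d ∷ t ∷ u ∷ []) → α t ≡ 0 → α u ≡ 0 →
         PAIR a b d t u ⊢ α ⇛ α [ d ≔ α d + pair (α a) (α b) ] [ a ≔ 0 ] [ b ≔ 0 ]
pair-⇛ {a} {b} {d} {t} {u} {α}
       ((a≢b ∷ a≢d ∷ a≢t ∷ a≢u ∷ []) ∷ (b≢d ∷ b≢t ∷ b≢u ∷ []) ∷ (d≢t ∷ d≢u ∷ []) ∷ (t≢u ∷ []) ∷ [] ∷ [])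
       (d≢J ∷ t≢J ∷ u≢J ∷ []) αt≡0 αu≡0 =
  ⇛-seq (move2-⇛ b≢d b≢t d≢t d≢J t≢J) (⇛-seq (move-⇛ a≢t t≢J) (⇛-≗ paired (tri-⇛ (≢-sym d≢t) t≢u d≢u t≢J d≢J u≢J α₂u≡0)))
  where
  α₁₁ : Regs
  α₁₁ = α [ t ≔ α t + α b ]
  α₁₂ : Regs
  α₁₂ = α₁₁ [ d ≔ α d + α b ]
  α₁ : Regs
  α₁ = α₁₂ [ b ≔ 0 ]
  α₂₁ : Regs
  α₂₁ = α₁ [ t ≔ α₁ t + α₁ a ]
  α₂ : Regs
  α₂ = α₂₁ [ a ≔ 0 ]
  α₃₁ : Regs
  α₃₁ = α₂ [ d ≔ α₂ d + tri (α₂ t) ]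
  α₃ : Regs
  α₃ = α₃₁ [ t ≔ 0 ]
  α₁-other : ∀ {i} → i ≢ b → i ≢ d → i ≢ t → α₁ i ≡ α i
  α₁-other i≢b i≢d i≢t = trans (update-other α₁₂ b 0 i≢b) (trans (update-other α₁₁ d _ i≢d) (update-other α t _ i≢t))
  α₂-other : ∀ {i} → i ≢ a → i ≢ b → i ≢ d → i ≢ t → α₂ i ≡ α i
  α₂-other i≢a i≢b i≢d i≢t = trans (update-other α₂₁ a 0 i≢a) (trans (update-other α₁ t _ i≢t) (α₁-other i≢b i≢d i≢t))
  α₂u≡0 : α₂ u ≡ 0
  α₂u≡0 = trans (α₂-other (≢-sym a≢u) (≢-sym b≢u) (≢-sym d≢u) (≢-sym t≢u)) αu≡0
  α₁t : α₁ t ≡ α b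
  α₁t = trans (update-other α₁₂ b 0 (≢-sym b≢t)) (trans (update-other α₁₁ d _ (≢-sym d≢t))
              (trans (update-same α t _) (cong (_+ α b) αt≡0)))
  α₂t : α₂ t ≡ α a + α b
  α₂t = trans (update-other α₂₁ a 0 (≢-sym a≢t)) (trans (update-same α₁ t _)
              (trans (cong₂ _+_ α₁t (α₁-other a≢b a≢d a≢t)) (+-comm (α b) (α a))))
  α₂d : α₂ d ≡ α d + α b
  α₂d = trans (update-other α₂₁ a 0 (≢-sym a≢d)) (trans (update-other α₁ t _ d≢t)
              (trans (update-other α₁₂ b 0 (≢-sym b≢d)) (update-same α₁₁ d _)))
  pairing : α₂ d + tri (α₂ t) ≡ α d + pair (α a) (α b)
  pairing = trans (cong₂ (λ x y → x + tri y) α₂d α₂t)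
                  (trans (+-assoc (α d) (α b) _) (cong (α d +_) (+-comm (α b) (tri (α a + α b)))))
  β₁ : Regs
  β₁ = α [ d ≔ α d + pair (α a) (α b) ]
  β₂ : Regs
  β₂ = β₁ [ a ≔ 0 ]
  paired : α₃ ≗ β₂ [ b ≔ 0 ]
  paired = ≗-by (a ∷ b ∷ d ∷ t ∷ [])
    ( trans (update-other α₃₁ t 0 a≢t) (trans (update-other α₂ d _ a≢d) (trans (update-same α₂₁ a 0)
            (sym (trans (update-other β₂ b 0 a≢b) (update-same β₁ a 0)))))
    ∷ trans (update-other α₃₁ t 0 b≢t) (trans (update-other α₂ d _ b≢d) (trans (update-other α₂₁ a 0 (≢-sym a≢b))
            (trans (update-other α₁ t _ b≢t) (trans (update-same α₁₂ b 0) (sym (update-same β₂ b 0))))))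
    ∷ trans (update-other α₃₁ t 0 d≢t) (trans (update-same α₂ d _) (trans pairing
            (sym (trans (update-other β₂ b 0 (≢-sym b≢d)) (trans (update-other β₁ a 0 (≢-sym a≢d)) (update-same α d _))))))
    ∷ trans (update-same α₃₁ t 0) (trans (sym αt≡0) (sym (trans (update-other β₂ b 0 (≢-sym b≢t))
            (trans (update-other β₁ a 0 (≢-sym a≢t)) (update-other α d _ (≢-sym d≢t))))))
    ∷ [])
    λ { (i≢a ∷ i≢b ∷ i≢d ∷ i≢t ∷ []) →
          trans (update-other α₃₁ t 0 i≢t) (trans (update-other α₂ d _ i≢d) (trans (α₂-other i≢a i≢b i≢d i≢t)
                (sym (trans (update-other β₂ b 0 i≢b) (trans (update-other β₁ a 0 i≢a) (update-other α d _ i≢d)))))) }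

data Expr : Set where
  lit  : ℕ → Expr
  var  : ℕ → Expr
  succ : Expr → Expr
  ⟨_,_⟩ : Expr → Expr → Expr

⟦_⟧ : Expr → Regs → ℕ
⟦ lit k ⟧ α = k
⟦ var r ⟧ α = α r
⟦ succ e ⟧ α = suc (⟦ e ⟧ α)
⟦ ⟨ e₁ , e₂ ⟩ ⟧ α = pair (⟦ e₁ ⟧ α) (⟦ e₂ ⟧ α)

vars : Expr → List ℕ
vars (lit _) = []
vars (var r) = [ r ]
vars (succ e) = vars e
vars ⟨ e₁ , e₂ ⟩ = vars e₁ ++ vars e₂

⟦⟧-cong : ∀ e {α β} → All (λ r → α r ≡ β r) (vars e) → ⟦ e ⟧ α ≡ ⟦ e ⟧ β
⟦⟧-cong (lit k) _ = refl
⟦⟧-cong (var r) (αr≡βr ∷ []) = αr≡βr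
⟦⟧-cong (succ e) agree = cong suc (⟦⟧-cong e agree)
⟦⟧-cong ⟨ e₁ , e₂ ⟩ agree with agree₁ , agree₂ ← All.++⁻ (vars e₁) agree = cong₂ pair (⟦⟧-cong e₁ agree₁) (⟦⟧-cong e₂ agree₂)

-- compile e d t adds the value of e to register d; the registers from t on serve as a stack of
-- scratch registers, which are 0 before and after.
compile : Expr → ℕ → ℕ → Stmt
compile (lit k) d t = LIT d k
compile (var r) d t = COPY r d t
compile (succ e) d t = compile e d t ⨾ INC d
compile ⟨ e₁ , e₂ ⟩ d t = compile e₁ t (2 + t) ⨾ compile e₂ (1 + t) (2 + t) ⨾ PAIR t (1 + t) d (2 + t) (3 + t)

zero-from : ∀ {α : Regs} t → (∀ i → α (t + i) ≡ 0) → ∀ {i} → t ≤ i → α i ≡ 0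
zero-from t zero-above t≤i with k , refl ← m≤n⇒∃[o]m+o≡n t≤i = zero-above k

<⇒≢+ : ∀ {m n} k → m < n → m ≢ k + n
<⇒≢+ k m<n = <⇒≢ (<-≤-trans m<n (m≤n+m _ k))

Readable : ℕ → ℕ → ℕ → Set
Readable d t r = r < t × r ≢ d × r ≢ jumpReg

compile-⇛ : ∀ e {d t α} → d < t → jumpReg < t → d ≢ jumpReg → All (Readable d t) (vars e) →
            (∀ i → α (t + i) ≡ 0) → compile e d t ⊢ α ⇛ α [ d ≔ α d + ⟦ e ⟧ α ]
compile-⇛ (lit k) d<t J<t d≢J readable scratch = lit-⇛ k d≢J
compile-⇛ (var r) {t = t} {α} d<t J<t d≢J ((r<t , r≢d , r≢J) ∷ []) scratch =
  copy-⇛ r≢d (<⇒≢+ 0 r<t) (<⇒≢+ 0 d<t) r≢J d≢J (≢-sym (<⇒≢+ 0 J<t)) (zero-from {α} t scratch ≤-refl)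
compile-⇛ (succ e) {d} {t} {α} d<t J<t d≢J readable scratch =
  ⇛-seq (compile-⇛ e d<t J<t d≢J readable scratch)
        (⇛-≗ (≗-update (trans (update-same β d _) (trans (cong suc (update-same α d _)) (sym (+-suc (α d) _))))
                       (λ i≢d → trans (update-other β d _ i≢d) (update-other α d _ i≢d)))
             (⇛-inc d≢J))
  where
  β : Regs
  β = α [ d ≔ α d + ⟦ e ⟧ α ]
compile-⇛ ⟨ e₁ , e₂ ⟩ {d} {t} {α} d<t J<t d≢J readable scratch
  with readable₁ , readable₂ ← All.++⁻ (vars e₁) readable =
  ⇛-seq (compile-⇛ e₁ (m<n+m t (s≤s z≤n)) J<2+t (≢-sym (<⇒≢+ 0 J<t)) (All.map (widen 0) readable₁)
                   (λ i → scratch₁ (m≤m+n (2 + t) i)))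
  (⇛-seq (compile-⇛ e₂ ≤-refl J<2+t (≢-sym (<⇒≢+ 1 J<t)) (All.map (widen 1) readable₂)
                   (λ i → scratch₂ (m≤m+n (2 + t) i)))
         (⇛-≗ paired (pair-⇛ distinct (d≢J ∷ ≢-sym (<⇒≢+ 2 J<t) ∷ ≢-sym (<⇒≢+ 3 J<t) ∷ [])
                             (scratch-α₂ ≤-refl) (scratch-α₂ (m≤n⇒m≤1+n ≤-refl)))))
  where
  zero-at : ∀ {i} → t ≤ i → α i ≡ 0
  zero-at = zero-from {α} t scratch
  J<2+t : jumpReg < 2 + t
  J<2+t = <-≤-trans J<t (m≤n+m t 2)
  ≢+ : ∀ n k → n ≢ suc k + n
  ≢+ n k = <⇒≢ (m<n+m n (s≤s z≤n))
  widen : ∀ k {r} → Readable d t r → Readable (k + t) (2 + t) r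
  widen k (r<t , _ , r≢J) = <-≤-trans r<t (m≤n+m t 2) , <⇒≢+ k r<t , r≢J
  α₁ : Regs
  α₁ = α [ t ≔ α t + ⟦ e₁ ⟧ α ]
  α₂ : Regs
  α₂ = α₁ [ 1 + t ≔ α₁ (1 + t) + ⟦ e₂ ⟧ α₁ ]
  scratch₁ : ∀ {i} → 2 + t ≤ i → α i ≡ 0
  scratch₁ le = zero-at (≤-trans (m≤n+m t 2) le)
  scratch₂ : ∀ {i} → 2 + t ≤ i → α₁ i ≡ 0
  scratch₂ le = trans (update-other α t _ (≢-sym (<⇒≢ (<-≤-trans (m<n+m t (s≤s z≤n)) le)))) (scratch₁ le)
  scratch-α₂ : ∀ {i} → 2 + t ≤ i → α₂ i ≡ 0
  scratch-α₂ le = trans (update-other α₁ (1 + t) _ (≢-sym (<⇒≢ (<-≤-trans ≤-refl le)))) (scratch₂ le)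
  distinct : Unique (t ∷ 1 + t ∷ d ∷ 2 + t ∷ 3 + t ∷ [])
  distinct = (≢+ t 0 ∷ ≢-sym (<⇒≢ d<t) ∷ ≢+ t 1 ∷ ≢+ t 2 ∷ []) ∷ (≢-sym (<⇒≢+ 1 d<t) ∷ ≢+ (1 + t) 0 ∷ ≢+ (1 + t) 1 ∷ []) ∷
             (<⇒≢+ 2 d<t ∷ <⇒≢+ 3 d<t ∷ []) ∷ (≢+ (2 + t) 0 ∷ []) ∷ [] ∷ []
  α₂t : α₂ t ≡ ⟦ e₁ ⟧ α
  α₂t = trans (update-other α₁ (1 + t) _ (≢+ t 0)) (trans (update-same α t _) (cong (_+ ⟦ e₁ ⟧ α) (zero-at ≤-refl)))
  α₂1+t : α₂ (1 + t) ≡ ⟦ e₂ ⟧ α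
  α₂1+t = trans (update-same α₁ (1 + t) _) (cong₂ _+_ (trans (update-other α t _ (≢-sym (≢+ t 0))) (zero-at (m≤n⇒m≤1+n ≤-refl)))
                                                      (⟦⟧-cong e₂ (All.map agree readable₂)))
    where
    agree : ∀ {r} → Readable d t r → α₁ r ≡ α r
    agree (r<t , _ , _) = update-other α t _ (<⇒≢+ 0 r<t)
  α₂-other : ∀ {i} → i ≢ t → i ≢ 1 + t → α₂ i ≡ α i
  α₂-other i≢t i≢1+t = trans (update-other α₁ (1 + t) _ i≢1+t) (update-other α t _ i≢t)
  γ₁ : Regs
  γ₁ = α₂ [ d ≔ α₂ d + pair (α₂ t) (α₂ (1 + t)) ]
  γ₂ : Regs
  γ₂ = γ₁ [ t ≔ 0 ]
  paired : γ₂ [ 1 + t ≔ 0 ] ≗ α [ d ≔ α d + pair (⟦ e₁ ⟧ α) (⟦ e₂ ⟧ α) ]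
  paired = ≗-by (t ∷ 1 + t ∷ d ∷ [])
    ( trans (update-other γ₂ (1 + t) 0 (≢+ t 0)) (trans (update-same γ₁ t 0)
            (sym (trans (update-other α d _ (≢-sym (<⇒≢ d<t))) (zero-at ≤-refl))))
    ∷ trans (update-same γ₂ (1 + t) 0) (sym (trans (update-other α d _ (≢-sym (<⇒≢+ 1 d<t))) (zero-at (m≤n⇒m≤1+n ≤-refl))))
    ∷ trans (update-other γ₂ (1 + t) 0 (<⇒≢+ 1 d<t)) (trans (update-other γ₁ t 0 (<⇒≢ d<t)) (trans (update-same α₂ d _)
            (trans (cong₂ _+_ (α₂-other (<⇒≢ d<t) (<⇒≢+ 1 d<t)) (cong₂ pair α₂t α₂1+t)) (sym (update-same α d _)))))
    ∷ [])
    λ { (i≢t ∷ i≢1+t ∷ i≢d ∷ []) → trans (update-other γ₂ (1 + t) 0 i≢1+t) (trans (update-other γ₁ t 0 i≢t)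
          (trans (update-other α₂ d _ i≢d) (trans (α₂-other i≢t i≢1+t) (sym (update-other α d _ i≢d))))) }

-- Computing the encoded input

-- The input E arrives in register 0; the prelude leaves encodedInput E there and 0 everywhere else.
cnt ereg acc ln new scratch : ℕ
cnt = 2
ereg = 3
acc = 4
ln = 5
new = 6
scratch = 7

eventE : Expr → Expr → Expr → Expr
eventE l q q' = ⟨ lit 0 , ⟨ l , ⟨ q , q' ⟩ ⟩ ⟩

loadStepE : Expr
loadStepE = succ ⟨ eventE (var ln) (lit ⌜ probe 0 ⌝) (lit ⌜ gate full 0 ⌝) , var acc ⟩

emptyLoadE : Expr
emptyLoadE = succ ⟨ eventE (lit 0) (lit ⌜ halted ⌝) (lit ⌜ final ⌝) , lit 0 ⟩

inputE : Expr
inputE = ⟨ ⟨ lit ⌜ initial ⌝ , succ ⟨ ⟨ lit ⌜ initial ⌝ , ⟨ var acc , lit ⌜ at 0 ⌝ ⟩ ⟩ , var ereg ⟩ ⟩ , lit ⌜ final ⌝ ⟩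

LOAD-STEP : Stmt
LOAD-STEP = compile loadStepE new scratch ⨾ CLEAR acc ⨾ MOVE new acc ⨾ LIT ln 2

PRELUDE : Stmt
PRELUDE = MOVE2 0 ereg cnt ⨾ compile emptyLoadE acc scratch ⨾ LIT ln 2 ⨾ LOOP cnt LOAD-STEP ⨾
          compile inputE 0 scratch ⨾ CLEAR acc ⨾ CLEAR ereg ⨾ CLEAR ln

encodedLoad : ℕ → ℕ
encodedLoad j = encList encEvent (loadBody j)

functionsCode : Program → ℕ
functionsCode P = encList encFun (numberFuns 0 (machineFuns 0 P))

-- By definition, encInput (machineContract P (functionsCode P)) ⌜ final ⌝ is encodedInput (functionsCode P).
encodedInput : ℕ → ℕ
encodedInput E = pair (pair ⌜ initial ⌝ (suc (pair (pair ⌜ initial ⌝ (pair (encodedLoad E) ⌜ at 0 ⌝)) E))) ⌜ final ⌝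

pattern 7+ i = suc (suc (suc (suc (suc (suc (suc i))))))

loading : ℕ → ℕ → Regs
loading E j = (λ _ → 0) [ ereg ≔ E ] [ acc ≔ encodedLoad j ] [ ln ≔ 2 * suc j ]

load-step : ∀ E k j → LOAD-STEP ⊢ loading E j [ cnt ≔ k ] ⇛ loading E (1 + j) [ cnt ≔ k ]
load-step E k j =
  ⇛-seq (compile-⇛ loadStepE (<ᵇ⇒< 6 7 _) (<ᵇ⇒< 1 7 _) (λ ())
                   ((<ᵇ⇒< 5 7 _ , (λ ()) , (λ ())) ∷ (<ᵇ⇒< 4 7 _ , (λ ()) , (λ ())) ∷ [])
                   (λ _ → refl))
  (⇛-seq clear-⇛ (⇛-seq (move-⇛ (λ ()) (λ ()))
  (⇛-≗ (λ { 0 → refl ; 1 → refl ; 2 → refl ; 3 → refl ; 4 → refl ; 6 → refl ; (7+ _) → refl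
          ; 5 → trans (+-comm (2 * suc j) 2) (sym (*-suc 2 (suc j))) })
       (lit-⇛ 2 (λ ())))))

prelude-⇛ : ∀ E → PRELUDE ⊢ regs (start E) ⇛ regs (start (encodedInput E))
prelude-⇛ E =
  ⇛-seq (move2-⇛ (λ ()) (λ ()) (λ ()) (λ ()) (λ ()))
  (⇛-seq (compile-⇛ emptyLoadE (<ᵇ⇒< 4 7 _) (<ᵇ⇒< 1 7 _) (λ ()) [] (λ _ → refl))
  (⇛-seq (lit-⇛ 2 (λ ()))
  (⇛-seq (⇛-pre (λ { 0 → refl ; 1 → refl ; 2 → refl ; 3 → refl ; 4 → refl ; 5 → refl ; 6 → refl ; (7+ _) → refl })
                (⇛-≗ loaded (loop-⇛ (loading E) (λ _ → 1) (load-step E) E 0)))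
  (⇛-seq (compile-⇛ inputE (<ᵇ⇒< 0 7 _) (<ᵇ⇒< 1 7 _) (λ ())
                    ((<ᵇ⇒< 4 7 _ , (λ ()) , (λ ())) ∷ (<ᵇ⇒< 3 7 _ , (λ ()) , (λ ())) ∷ [])
                    (λ _ → refl))
  (⇛-seq clear-⇛ (⇛-seq clear-⇛
  (⇛-≗ (λ { 0 → refl ; 1 → refl ; 2 → refl ; 3 → refl ; 4 → refl ; 5 → refl ; 6 → refl ; (7+ _) → refl }) clear-⇛)))))))
  where
  loaded : loading E (accumulate (λ _ → 1) E 0) [ cnt ≔ 0 ] ≗ loading E E [ cnt ≔ 0 ]
  loaded i = cong (λ j → (loading E j [ cnt ≔ 0 ]) i) (trans (accumulate-1 E 0) (+-identityʳ E))

-- The diagonal program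

nth-map : ∀ {A B : Set} (f : A → B) xs {k x} → nth xs k ≡ just x → nth (map f xs) k ≡ just (f x)
nth-map f (x ∷ xs) {zero} refl = refl
nth-map f (x ∷ xs) {suc k} eq = nth-map f xs eq

nth-length : ∀ {A : Set} (xs : List A) {k x} → nth xs k ≡ just x → k < length xs
nth-length (x ∷ xs) {zero} _ = s≤s z≤n
nth-length (x ∷ xs) {suc k} eq = s≤s (nth-length xs eq)

nth-outside : ∀ {A : Set} (xs : List A) {k} → nth xs k ≡ nothing → length xs ≤ k
nth-outside [] _ = z≤n
nth-outside (x ∷ xs) {suc k} eq = s≤s (nth-outside xs eq)

module Diagonal (M : Program) where

  oM : ℕ
  oM = len PRELUDE

  oF : ℕ
  oF = oM + length M

  -- M stops at a halt instruction or by jumping outside M; both lead to the finale at oF.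
  relabel : ℕ → ℕ
  relabel l = if l <ᵇ length M then oM + l else oF

  relocate : Instr → Instr
  relocate (inc r l) = inc r (relabel l)
  relocate (dec r l₁ l₂) = dec r (relabel l₁) (relabel l₂)
  relocate halt = jump oF

  -- Register 0 holds M's answer: 0 leads to halt, any other value to a self-loop.
  finale : List Instr
  finale = dec 0 (oF + 1) (oF + 2) ∷ jump (oF + 1) ∷ halt ∷ []

  B : Program
  B = code 0 PRELUDE ++ map relocate M ++ finale

  nth-after-prelude : ∀ k → nth B (oM + k) ≡ nth (map relocate M ++ finale) k
  nth-after-prelude k = subst (λ o → nth B (o + k) ≡ nth (map relocate M ++ finale) k) (length-code 0 PRELUDE)
                              (nth-++ʳ (code 0 PRELUDE) (map relocate M ++ finale) k)

  nth-relocated : ∀ {k x} → nth M k ≡ just x → nth B (oM + k) ≡ just (relocate x)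
  nth-relocated {k} eq = trans (nth-after-prelude k) (nth-++ˡ (map relocate M) finale (nth-map relocate M eq))

  nth-finale : ∀ k → nth B (oF + k) ≡ nth finale k
  nth-finale k = trans (cong (nth B) (+-assoc oM (length M) k))
                       (trans (nth-after-prelude (length M + k))
                              (subst (λ n → nth (map relocate M ++ finale) (n + k) ≡ nth finale k) (length-map relocate M)
                                     (nth-++ʳ (map relocate M) finale k)))

  relabel-inside : ∀ {k} → k < length M → relabel k ≡ oM + k
  relabel-inside {k} k<n with k <ᵇ length M | <⇒<ᵇ k<n
  ... | true | _ = refl

  relabel-outside : ∀ {k} → length M ≤ k → relabel k ≡ oF
  relabel-outside {k} n≤k with k <ᵇ length M | <ᵇ⇒< k (length M)
  ... | false | _ = refl
  ... | true | k<n = ⊥-elim (<⇒≱ (k<n _) n≤k)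

  relabel-0 : relabel 0 ≡ oM
  relabel-0 with length M
  ... | zero = +-identityʳ oM
  ... | suc _ = +-identityʳ oM

  Tracks : MConf → MConf → Set
  Tracks c d = pc d ≡ relabel (pc c) × regs d ≗ regs c

  nth-tracked : ∀ {p x} → nth M p ≡ just x → nth B (relabel p) ≡ just (relocate x)
  nth-tracked eq = trans (cong (nth B) (relabel-inside (nth-length M eq))) (nth-relocated eq)

  tracks-step : ∀ {c c' d} → M ⊢ c ↝ c' → Tracks c d → ∃[ d' ] B ⊢ d ↝ d' × Tracks c' d'
  tracks-step {mconf p ρ} {d = mconf _ σ} s (refl , σ≗ρ) with nth M p in eq
  ... | nothing = ⊥-elim (outside-stuck eq s)
  ... | just halt = ⊥-elim (halt-stuck eq s)
  ... | just (inc r l) with refl ← ↝-deterministic s (↝-inc eq) =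
    _ , ↝-inc (nth-tracked eq) , refl ,
    λ i → trans (update-cong r _ σ≗ρ i) (cong (λ v → update ρ r (suc v) i) (σ≗ρ r))
  ... | just (dec r l₁ l₂) with ρ r in ρr≡
  ...   | zero with refl ← ↝-deterministic s (↝-dec-zero eq ρr≡) =
    _ , ↝-dec-zero (nth-tracked eq) (trans (σ≗ρ r) ρr≡) , refl , σ≗ρ
  ...   | suc v with refl ← ↝-deterministic s (↝-dec-suc eq ρr≡) =
    _ , ↝-dec-suc (nth-tracked eq) (trans (σ≗ρ r) ρr≡) , refl , update-cong r v σ≗ρ

  tracks-run : ∀ {c c' d} → M ⊢ c ↝* c' → Tracks c d → ∃[ d' ] B ⊢ d ↝* d' × Tracks c' d'
  tracks-run ε tracks = _ , ε , tracks
  tracks-run (s ◅ steps) tracks with d₁ , s' , tracks₁ ← tracks-step s tracks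
                                with d₂ , steps' , tracks₂ ← tracks-run steps tracks₁ = d₂ , s' ◅ steps' , tracks₂

  exits : ∀ {c d} → mstep M c ≡ nothing → Tracks c d → ∃[ d' ] B ⊢ d ↝* d' × pc d' ≡ oF × regs d' 0 ≡ regs c 0
  exits {mconf p ρ} {mconf _ σ} stuck (refl , σ≗ρ) with nth M p in eq
  ... | nothing = _ , ε , relabel-outside (nth-outside M eq) , σ≗ρ 0
  ... | just halt with _ , s , refl , kept ← ↝-jump (nth-tracked eq) = _ , s ◅ ε , refl , trans (kept (λ ())) (σ≗ρ 0)
  ... | just (inc r l) = case stuck of λ ()
  ... | just (dec r l₁ l₂) with ρ r in ρr≡
  ...   | zero = case stuck of λ ()
  ...   | suc v = case stuck of λ ()

  prelude-embedded : Embedded (code 0 PRELUDE) B 0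
  prelude-embedded = embed λ {k} eq → nth-++ˡ (code 0 PRELUDE) (map relocate M ++ finale) {k} eq

  reaches-finale : ∀ E {y} → HaltsWith M (encodedInput E) y →
                   ∃[ d ] B ⊢ start E ↝* d × pc d ≡ oF × regs d 0 ≡ y
  reaches-finale E (n , c , ran , stuck , output) =
    let σ , prelude⇓ , σ≗ = run (prelude-⇛ E) (λ _ → refl)
        d₁ , simulated , tracks = tracks-run (exec⇒↝* n ran) (sym relabel-0 , σ≗)
        d₂ , exited , pc≡ , out≡ = exits stuck tracks
    in d₂ , ⇓⇒↝* 0 prelude⇓ refl prelude-embedded ◅◅ simulated ◅◅ exited , pc≡ , trans out≡ output

  finale-entry : nth B oF ≡ just (dec 0 (oF + 1) (oF + 2))
  finale-entry = trans (cong (nth B) (sym (+-identityʳ oF))) (nth-finale 0)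

  rejects : ∀ E → HaltsWith M (encodedInput E) 0 → ReachesHalt B E
  rejects E halts =
    let d , to-finale , pc≡ , out≡0 = reaches-finale E halts
    in _ , to-finale ◅◅ ↝-dec-zero (trans (cong (nth B) pc≡) finale-entry) out≡0 ◅ ε , nth-finale 2

  accepts : ∀ E → HaltsWith M (encodedInput E) 1 → ¬ ReachesHalt B E
  accepts E halts (c , halting , at-halt) =
    let d , to-finale , pc≡ , out≡1 = reaches-finale E halts
    in trapped-never-halts (nth-finale 1) refl (to-finale ◅◅ ↝-dec-suc (trans (cong (nth B) pc≡) finale-entry) out≡1 ◅ ε)
                           halting at-halt

Decider : Program → Set
Decider M = (C : Contract) (Q : ℕ) → WellFormed C → Instantaneous C → DecidesOn M (encInput C Q) (Reachable C Q)

no-contrary-program : ∀ {M} → Decider M → ∀ B →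
                      (∀ E → HaltsWith M (encodedInput E) 0 → ReachesHalt B E) →
                      (∀ E → HaltsWith M (encodedInput E) 1 → ¬ ReachesHalt B E) → ⊥
no-contrary-program {M} decides B rejects accepts = unreachable (from reachable⇔halts (rejects E (proj₂ decision unreachable)))
  where
  open Equivalence
  E : ℕ
  E = functionsCode B
  decision : DecidesOn M (encodedInput E) (Reachable (machineContract B E) ⌜ final ⌝)
  decision = decides (machineContract B E) ⌜ final ⌝ (machineContract-wellFormed B E) (machineContract-instantaneous B E)
  reachable⇔halts : Reachable (machineContract B E) ⌜ final ⌝ ⇔ ReachesHalt B E
  reachable⇔halts = machineContract-reachable⇔halts B E
  unreachable : ¬ Reachable (machineContract B E) ⌜ final ⌝
  unreachable reachable = accepts E (proj₁ decision reachable) (to reachable⇔halts reachable)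

mainTheorem1 : ¬ Σ Program (λ M → (C : Contract) (Q : ℕ) → WellFormed C → Instantaneous C →
                 DecidesOn M (encInput C Q) (Reachable C Q))
mainTheorem1 (M , decides) = no-contrary-program decides B rejects accepts
  where
  open Diagonal M
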